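{- For every $n\geqslant0$, $$\sum_{\pi\in\mathfrak{S}_{n+1}}x^{{\rm basc}(\pi)}y^{{\rm des}(\pi)-{\rm plrmin}(\pi)}s^{{\rm suc}(\pi)}t^{{\rm plrmin}(\pi)}=\sum_{\pi\in\mathfrak{S}_n}x^{{\rm exc}(\pi)}y^{{\rm drop}(\pi)}\left(\frac{t+s}{2}\right)^{{\rm fix}(\pi)}2^{{\rm cyc}(\pi)}.$$ In particular (taking $t=y$), $$\sum_{\pi\in\mathfrak{S}_{n+1}}x^{{\rm basc}(\pi)}y^{{\rm des}(\pi)}s^{{\rm suc}(\pi)}=\sum_{\pi\in\mathfrak{S}_n}x^{{\rm exc}(\pi)}y^{{\rm drop}(\pi)}\left(\frac{y+s}{2}\right)^{{\rm fix}(\pi)}2^{{\rm cyc}(\pi)}.$$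
   Context: For $\pi\in\mathfrak{S}_n$: ${\rm des}(\pi)=\#\{i\in[n-1]:\pi(i)>\pi(i+1)\}$, ${\rm suc}(\pi)=\#\{i\in[n-1]:\pi(i+1)=\pi(i)+1\}$, ${\rm basc}(\pi)=\#\{i\in[n-1]:\pi(i+1)\geqslant\pi(i)+2\}$, ${\rm exc}(\pi)=\#\{i:\pi(i)>i\}$, ${\rm drop}(\pi)=\#\{i:\pi(i)<i\}$, ${\rm fix}(\pi)=\#\{i:\pi(i)=i\}$, ${\rm cyc}(\pi)$ the number of cycles. Set $\pi(n+1)=0$. A value $\pi(i)$ ($i\in[n]$) is a left-to-right minimum if $i=1$ or $\pi(i)<\pi(j)$ for all $j<i$; it is a proper left-to-right minimum if moreover $\pi(i)\neq1$ and there is $k>i$ with $\pi(k)=\pi(i)-1$ and $\pi(k)>\pi(k+1)$; ${\rm plrmin}(\pi)$ counts these. The empty permutation ($n=0$) contributes $1$. -}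

module Defs where

open import Data.Bool using (Bool; true; false; _∧_; _∨_; not; if_then_else_)
open import Data.Nat as ℕ using (ℕ; zero; suc; _∸_; _≡ᵇ_; _<ᵇ_)
open import Data.List using (List; []; _∷_; length; map; foldr; concatMap; filterᵇ)
open import Data.Bool.ListAction using (all; any)
open import Data.Rational as ℚ using (ℚ; 0ℚ; 1ℚ; _+_; _*_; ½)

-- Permutations of [n] are represented in one-line notation as lists
-- w = [π(1), ..., π(n)] of natural numbers.

range : ℕ → ℕ → List ℕ
range a zero = []
range a (suc b) with suc b <ᵇ a
... | true  = []
... | false = range a b Data.List.++ (suc b ∷ [])

oneTo : ℕ → List ℕ
oneTo n = range 1 n

words : ℕ → ℕ → List (List ℕ)
words n zero    = [] ∷ []
words n (suc k) = concatMap (λ a → map (a ∷_) (words n k)) (oneTo n)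

-- a word of length n over [1..n] is a permutation iff it contains every j ∈ [1..n]
isPerm : ℕ → List ℕ → Bool
isPerm n w = all (λ j → any (λ a → a ≡ᵇ j) w) (oneTo n)

perms : ℕ → List (List ℕ)
perms n = filterᵇ (isPerm n) (words n n)

-- π(i), 1-indexed; 0 out of range (so in particular π(n+1) = 0)
at : List ℕ → ℕ → ℕ
at []       i             = 0
at (a ∷ w)  zero          = 0
at (a ∷ w)  (suc zero)    = a
at (a ∷ w)  (suc (suc i)) = at w (suc i)

count : (ℕ → Bool) → List ℕ → ℕ
count p = foldr (λ i c → if p i then suc c else c) 0

_>ᵇ_ : ℕ → ℕ → Bool
a >ᵇ b = b <ᵇ a

_≥ᵇ_ : ℕ → ℕ → Bool
a ≥ᵇ b = not (a <ᵇ b)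

module _ (π : List ℕ) where
  private
    n = length π
    p = at π

  des suc' basc exc drop fix : ℕ
  des   = count (λ i → p i >ᵇ p (suc i)) (oneTo (n ∸ 1))
  suc'  = count (λ i → p (suc i) ≡ᵇ suc (p i)) (oneTo (n ∸ 1))
  basc  = count (λ i → p (suc i) ≥ᵇ suc (suc (p i))) (oneTo (n ∸ 1))
  exc   = count (λ i → p i >ᵇ i) (oneTo n)
  drop  = count (λ i → p i <ᵇ i) (oneTo n)
  fix   = count (λ i → p i ≡ᵇ i) (oneTo n)

  iter : ℕ → ℕ → ℕ
  iter zero    i = i
  iter (suc k) i = p (iter k i)

  -- number of cycles = number of i ∈ [n] that are the least element of their cycle
  -- (the cycle of i is {π^k(i) : 1 ≤ k ≤ n})
  cyc : ℕ
  cyc = count (λ i → all (λ k → i ℕ.≤ᵇ iter k i) (oneTo n)) (oneTo n)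

  isLrmin : ℕ → Bool
  isLrmin i = all (λ j → p i <ᵇ p j) (oneTo (i ∸ 1))

  -- π(i) is a proper left-to-right minimum (with π(n+1) = 0)
  isPlrmin : ℕ → Bool
  isPlrmin i = isLrmin i ∧ not (p i ≡ᵇ 1)
             ∧ any (λ k → (p k ≡ᵇ (p i ∸ 1)) ∧ (p k >ᵇ p (suc k))) (range (suc i) n)

  plrmin : ℕ
  plrmin = count isPlrmin (oneTo n)

_^_ : ℚ → ℕ → ℚ
q ^ zero  = 1ℚ
q ^ suc k = q * (q ^ k)

Σ[_]_ : List (List ℕ) → (List ℕ → ℚ) → ℚ
Σ[ ps ] f = foldr (λ π acc → f π + acc) 0ℚ ps

2ℚ : ℚ
2ℚ = 1ℚ + 1ℚ

module Submission where

-- Both sides obey one recursion on weights g of the four statistics.  Every permutation of [n+2]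
-- arises exactly once by inserting n+2 into the one-line notation of a permutation of [n+1], in
-- front or right after a letter x.  How (basc, des - plrmin, suc, plrmin) changes depends only on
-- the kind of the slot: x = n+1, x followed by x+1, by a letter above x+1, or by a smaller letter,
-- the last case split by whether x+1 is an earlier left-to-right minimum (such descents are in
-- bijection with the proper left-to-right minima).  The number of slots of each kind is itself one
-- of the statistics, so the sum of g over 𝔖_{n+2} is the sum of letterStep g over 𝔖_{n+1}.
-- Likewise every permutation of [n+1] arises once by inserting n+1 into the cycles of a permutation
-- of [n], as a new fixed point or right after some i, which yields cycleStep on (exc, drop, fix, cyc).
-- The map transfer g (e, d, f, c) = 2^c 2^-f Σ_{j+k=f} C(f,j) g (e, d, j, k) intertwines the two,
-- transfer ∘ letterStep = cycleStep ∘ transfer, so by induction the sum of g over 𝔖_{n+1} is the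
-- sum of transfer g over 𝔖_n.  For the monomial weight the binomial theorem turns transfer g into
-- x^exc y^drop ((t+s)/2)^fix 2^cyc; t = y and plrmin ≤ des give the second identity.

module Permutations where

  open import Defs
  open import Function using (_∘_; _$_; _⇔_; mk⇔; Equivalence; case_of_)
  open import Algebra.Bundles using (CommutativeMonoid)
  open import Data.Nat as ℕ using (ℕ; zero; suc; _+_; _≤_; z≤n; s≤s)
  import Data.Nat.Properties as ℕ
  open import Data.Nat.Properties using (≡ᵇ⇒≡; ≡⇒≡ᵇ)
  open import Data.Product using (_×_; _,_; proj₁; proj₂; ∃; ∃₂)
  open import Data.Sum using (inj₁; inj₂)
  open import Data.List using (List; []; _∷_; _++_; _∷ʳ_; [_]; length; map; foldr; concatMap; applyUpTo; initLast; _∷ʳ′_)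
  open import Data.List.Properties
    using (applyUpTo-∷ʳ; length-applyUpTo; foldr-map; ∷-injective; ∷-injectiveˡ; ∷-injectiveʳ; ∷ʳ-injectiveˡ; ∷ʳ-injectiveʳ; ∷ʳ-injective; ++-assoc; ++-identityʳ; ++-conicalʳ)
  open import Data.List.Membership.Propositional using (_∈_; _∉_; find)
  open import Data.List.Membership.Propositional.Properties
    using (∈-applyUpTo⁺; ∈-applyUpTo⁻; ∈-map⁺; ∈-map⁻; ∈-concatMap⁺; ∈-concatMap⁻; ∈-filter⁺; ∈-filter⁻; ∈-∃++; ∈-++⁻; ∈-++⁺ˡ; ∈-++⁺ʳ; ∈-insert)
  open import Data.List.Membership.Propositional.Properties.WithK using (unique∧set⇒bag)
  open import Data.List.Relation.Unary.Any using (Any; here; there)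
  import Data.List.Relation.Unary.Any as Any
  import Data.List.Relation.Unary.All as All
  open import Data.List.Relation.Unary.All.Properties using (all⁺; all⁻)
  open import Data.List.Relation.Unary.Any.Properties using (any⁺; any⁻)
  import Data.List.Relation.Unary.AllPairs as AllPairs
  open import Data.List.Relation.Unary.Unique.Propositional using (Unique)
  import Data.List.Relation.Unary.Unique.Propositional.Properties as Unique
  open import Data.List.Relation.Binary.Permutation.Propositional
    using (_↭_; ↭-refl; ↭-reflexive; ↭-sym; ↭-trans; ↭-prep; ↭⇒↭ₛ)
  open import Data.List.Relation.Binary.Permutation.Propositional.Properties
    using (∈-resp-↭; ↭-length; shift; drop-mid; ∷↭∷ʳ; ++⁺ˡ; ++⁺ʳ) renaming (map⁺ to ↭-map⁺)
  import Data.List.Relation.Binary.Permutation.Setoid.Properties as Permₛ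
  open import Data.List.Relation.Binary.BagAndSetEquality using (∼bag⇒↭)
  open import Data.Rational as ℚ using (ℚ; 0ℚ)
  import Data.Rational.Properties as ℚ
  open import Algebra.Properties.CommutativeSemigroup (CommutativeMonoid.commutativeSemigroup ℚ.+-0-commutativeMonoid)
    using (interchange)
  open import Relation.Binary.PropositionalEquality hiding ([_])
  open import Relation.Nullary using (contradiction; T?; yes; no)

  oneTo≡applyUpTo : ∀ n → oneTo n ≡ applyUpTo suc n
  oneTo≡applyUpTo zero    = refl
  oneTo≡applyUpTo (suc n) = trans (cong (_∷ʳ suc n) (oneTo≡applyUpTo n)) (applyUpTo-∷ʳ suc n)

  ∈-oneTo⁺ : ∀ {n i} → 1 ≤ i → i ≤ n → i ∈ oneTo n
  ∈-oneTo⁺ {n} {suc i} _ i≤n = subst (suc i ∈_) (sym (oneTo≡applyUpTo n)) (∈-applyUpTo⁺ suc i≤n)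

  ∈-oneTo⁻ : ∀ {n i} → i ∈ oneTo n → 1 ≤ i × i ≤ n
  ∈-oneTo⁻ {n} i∈ with ∈-applyUpTo⁻ suc (subst (_ ∈_) (oneTo≡applyUpTo n) i∈)
  ... | j , j<n , refl = s≤s z≤n , j<n

  unique-oneTo : ∀ n → Unique (oneTo n)
  unique-oneTo n = subst Unique (sym (oneTo≡applyUpTo n))
    (Unique.applyUpTo⁺₁ suc n (λ i<j _ eq → ℕ.<-irrefl (ℕ.suc-injective eq) i<j))

  length-oneTo : ∀ n → length (oneTo n) ≡ n
  length-oneTo n = trans (cong length (oneTo≡applyUpTo n)) (length-applyUpTo suc n)

  record IsPerm (n : ℕ) (w : List ℕ) : Set where
    constructor mkPerm
    field ↭oneTo : w ↭ oneTo n

  open IsPerm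

  unique-↭ : ∀ {xs ys : List ℕ} → xs ↭ ys → Unique xs → Unique ys
  unique-↭ p = Permₛ.Unique-resp-↭ (setoid ℕ) (↭⇒↭ₛ p)

  perm-unique : ∀ {n w} → IsPerm n w → Unique w
  perm-unique {n} (mkPerm p) = unique-↭ (↭-sym p) (unique-oneTo n)

  perm-∈⇔ : ∀ {n w a} → IsPerm n w → a ∈ w ⇔ (1 ≤ a × a ≤ n)
  perm-∈⇔ (mkPerm p) = mk⇔ (λ a∈ → ∈-oneTo⁻ (∈-resp-↭ p a∈))
                  (λ (1≤a , a≤n) → ∈-resp-↭ (↭-sym p) (∈-oneTo⁺ 1≤a a≤n))

  perm-length : ∀ {n w} → IsPerm n w → length w ≡ n
  perm-length {n} (mkPerm p) = trans (↭-length p) (length-oneTo n)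

  ⊆∧length≤⇒↭ : ∀ {xs ys : List ℕ} → Unique xs → (∀ {a} → a ∈ xs → a ∈ ys) → length ys ≤ length xs → ys ↭ xs
  ⊆∧length≤⇒↭ {[]}     {[]}    _ _ _ = ↭-refl
  ⊆∧length≤⇒↭ {x ∷ xs} {ys} u@(_ AllPairs.∷ uxs) xs⊆ys ys≤ with ∈-∃++ (xs⊆ys (here refl))
  ... | l , r , refl = ↭-trans (shift x l r) (↭-prep x (⊆∧length≤⇒↭ uxs sub len))
    where
    sub : ∀ {a} → a ∈ xs → a ∈ l ++ r
    sub {a} a∈xs with ∈-++⁻ l (xs⊆ys (there a∈xs))
    ... | inj₁ a∈l         = ∈-++⁺ˡ a∈l
    ... | inj₂ (here refl) = contradiction a∈xs (Unique.Unique[x∷xs]⇒x∉xs u)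
    ... | inj₂ (there a∈r) = ∈-++⁺ʳ l a∈r
    len : length (l ++ r) ≤ length xs
    len = ℕ.≤-pred (subst (_≤ suc (length xs)) (↭-length (shift x l r)) ys≤)

  ∈-words⁺ : ∀ {n} k {w} → length w ≡ k → (∀ {a} → a ∈ w → a ∈ oneTo n) → w ∈ words n k
  ∈-words⁺ zero    {[]}    _   _   = here refl
  ∈-words⁺ (suc k) {a ∷ w} len w⊆ =
    ∈-concatMap⁺ _ (Any.map (λ { refl → ∈-map⁺ (a ∷_) (∈-words⁺ k (ℕ.suc-injective len) (w⊆ ∘ there)) })
                            (w⊆ (here refl)))

  ∈-words⁻ : ∀ {n} k {w} → w ∈ words n k → length w ≡ k
  ∈-words⁻ zero    (here refl) = refl
  ∈-words⁻ {n} (suc k) w∈ with Any.satisfied (∈-concatMap⁻ (λ a → map (a ∷_) (words n k)) {oneTo n} w∈)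
  ... | a , w∈a with ∈-map⁻ (a ∷_) w∈a
  ...   | w′ , w′∈ , refl = cong suc (∈-words⁻ k w′∈)

  unique-concatMap : ∀ {A B : Set} (f : A → List B) {xs} → Unique xs → (∀ {x} → x ∈ xs → Unique (f x))
    → (∀ {x x′ y} → x ∈ xs → x′ ∈ xs → y ∈ f x → y ∈ f x′ → x ≡ x′) → Unique (concatMap f xs)
  unique-concatMap f {[]}     _               _       _     = AllPairs.[]
  unique-concatMap f {x ∷ xs} (x≢xs AllPairs.∷ uxs) unique-f fibres =
    Unique.++⁺ (unique-f (here refl)) (unique-concatMap f uxs (unique-f ∘ there) (λ p q → fibres (there p) (there q)))
      λ (y∈fx , y∈rest) → let x′ , x′∈xs , y∈fx′ = find (∈-concatMap⁻ f y∈rest)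
                          in All.lookup x≢xs x′∈xs (fibres (here refl) (there x′∈xs) y∈fx y∈fx′)

  unique-words : ∀ n k → Unique (words n k)
  unique-words n zero    = All.[] AllPairs.∷ AllPairs.[]
  unique-words n (suc k) = unique-concatMap (λ a → map (a ∷_) (words n k)) {oneTo n} (unique-oneTo n)
    (λ _ → Unique.map⁺ ∷-injectiveʳ (unique-words n k))
    λ _ _ y∈ y∈′ → let _ , _ , e = ∈-map⁻ _ y∈ ; _ , _ , e′ = ∈-map⁻ _ y∈′ in ∷-injectiveˡ (trans (sym e) e′)

  ∈-perms⇔ : ∀ {n w} → w ∈ perms n ⇔ IsPerm n w
  ∈-perms⇔ {n} {w} = mk⇔ to from
    where
    to : w ∈ perms n → IsPerm n w
    to w∈ = let w∈words , isPerm-w = ∈-filter⁻ (T? ∘ isPerm n) w∈ in mkPerm $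
      ⊆∧length≤⇒↭ (unique-oneTo n)
        (λ j∈ → Any.map (λ a≡j → sym (≡ᵇ⇒≡ _ _ a≡j))
                        (any⁻ _ w (All.lookup (all⁺ _ (oneTo n) isPerm-w) j∈)))
        (ℕ.≤-reflexive (trans (∈-words⁻ n w∈words) (sym (length-oneTo n))))
    from : IsPerm n w → w ∈ perms n
    from (mkPerm p) = ∈-filter⁺ (T? ∘ isPerm n) (∈-words⁺ n (perm-length (mkPerm p)) (∈-resp-↭ p))
      (all⁻ _ (All.tabulate λ j∈ → any⁺ _ (Any.map (λ { {a} refl → ≡⇒≡ᵇ a a refl }) (∈-resp-↭ (↭-sym p) j∈))))

  unique-perms : ∀ n → Unique (perms n)
  unique-perms n = Unique.filter⁺ (T? ∘ isPerm n) (unique-words n n)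

  mapSplits : {A : Set} → (List ℕ → ℕ → List ℕ → A) → List ℕ → List A
  mapSplits f []      = []
  mapSplits f (a ∷ v) = f [] a v ∷ mapSplits (λ R → f (a ∷ R)) v

  ∈-mapSplits⁺ : ∀ {A : Set} (f : List ℕ → ℕ → List ℕ → A) R {a v} → f R a v ∈ mapSplits f (R ++ a ∷ v)
  ∈-mapSplits⁺ f []      = here refl
  ∈-mapSplits⁺ f (b ∷ R) = there (∈-mapSplits⁺ (λ R → f (b ∷ R)) R)

  ∈-mapSplits⁻ : ∀ {A : Set} (f : List ℕ → ℕ → List ℕ → A) w {y} → y ∈ mapSplits f w
    → ∃ λ R → ∃₂ λ a v → w ≡ R ++ a ∷ v × y ≡ f R a v
  ∈-mapSplits⁻ f (a ∷ v) (here refl) = [] , a , v , refl , refl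
  ∈-mapSplits⁻ f (a ∷ v) (there y∈) with ∈-mapSplits⁻ (λ R → f (a ∷ R)) v y∈
  ... | R , b , u , refl , refl = a ∷ R , b , u , refl , refl

  unique-mapSplits : ∀ {A : Set} (f : List ℕ → ℕ → List ℕ → A) w
    → (∀ {R a v R′ a′ v′} → w ≡ R ++ a ∷ v → w ≡ R′ ++ a′ ∷ v′ → f R a v ≡ f R′ a′ v′ → R ≡ R′)
    → Unique (mapSplits f w)
  unique-mapSplits f []      _     = AllPairs.[]
  unique-mapSplits f (a ∷ v) split =
    All.tabulate (λ y∈ eq → let R , b , u , v≡ , y≡ = ∈-mapSplits⁻ (λ R → f (a ∷ R)) v y∈ in
                            case split refl (cong (a ∷_) v≡) (trans eq y≡) of λ ())
    AllPairs.∷ unique-mapSplits (λ R → f (a ∷ R)) v (λ e e′ eq → ∷-injectiveʳ (split (cong (a ∷_) e) (cong (a ∷_) e′) eq))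

  split-unique : ∀ {m : ℕ} u u′ {v v′} → m ∉ u → m ∉ u′ → u ++ m ∷ v ≡ u′ ++ m ∷ v′ → u ≡ u′ × v ≡ v′
  split-unique []      []       _   _    refl = refl , refl
  split-unique []      (b ∷ u′) _   m∉u′ refl = contradiction (here refl) m∉u′
  split-unique (a ∷ u) []       m∉u _    refl = contradiction (here refl) m∉u
  split-unique (a ∷ u) (b ∷ u′) m∉u m∉u′ eq with ∷-injective eq
  ... | refl , eq′ with split-unique u u′ (m∉u ∘ there) (m∉u′ ∘ there) eq′
  ...   | refl , refl = refl , refl

  ΣL : {A : Set} → List A → (A → ℚ) → ℚ
  ΣL xs f = foldr (λ x acc → f x ℚ.+ acc) 0ℚ xs

  Σ-++ : ∀ {A : Set} (xs ys : List A) f → ΣL (xs ++ ys) f ≡ ΣL xs f ℚ.+ ΣL ys f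
  Σ-++ []       ys f = sym (ℚ.+-identityˡ _)
  Σ-++ (x ∷ xs) ys f = trans (cong (f x ℚ.+_) (Σ-++ xs ys f)) (sym (ℚ.+-assoc (f x) _ _))

  Σ-concatMap : ∀ {A B : Set} (g : A → List B) xs f → ΣL (concatMap g xs) f ≡ ΣL xs (λ a → ΣL (g a) f)
  Σ-concatMap g []       f = refl
  Σ-concatMap g (x ∷ xs) f = trans (Σ-++ (g x) (concatMap g xs) f) (cong (ΣL (g x) f ℚ.+_) (Σ-concatMap g xs f))

  Σ-cong : ∀ {A : Set} (xs : List A) {f g} → (∀ {x} → x ∈ xs → f x ≡ g x) → ΣL xs f ≡ ΣL xs g
  Σ-cong []       _   = refl
  Σ-cong (x ∷ xs) f≡g = cong₂ ℚ._+_ (f≡g (here refl)) (Σ-cong xs (f≡g ∘ there))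

  Σ-+ : ∀ {A : Set} (xs : List A) f g → ΣL xs (λ x → f x ℚ.+ g x) ≡ ΣL xs f ℚ.+ ΣL xs g
  Σ-+ []       f g = refl
  Σ-+ (x ∷ xs) f g = trans (cong (f x ℚ.+ g x ℚ.+_) (Σ-+ xs f g)) (interchange (f x) (g x) _ _)

  Σ-↭ : ∀ {A : Set} {xs ys : List A} → xs ↭ ys → ∀ f → ΣL xs f ≡ ΣL ys f
  Σ-↭ {xs = xs} {ys} xs↭ys f = begin
    ΣL xs f                    ≡⟨ foldr-map ℚ._+_ f 0ℚ xs ⟨
    foldr ℚ._+_ 0ℚ (map f xs)  ≡⟨ Permₛ.foldr-commMonoid (setoid ℚ) ℚ.+-0-isCommutativeMonoid (↭⇒↭ₛ (↭-map⁺ f xs↭ys)) ⟩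
    foldr ℚ._+_ 0ℚ (map f ys)  ≡⟨ foldr-map ℚ._+_ f 0ℚ ys ⟩
    ΣL ys f                    ∎
    where open ≡-Reasoning

  record InsertionScheme (N : ℕ) (ins : List ℕ → List (List ℕ)) : Set where
    field
      unique   : ∀ {p} → IsPerm N p → Unique (ins p)
      disjoint : ∀ {p p′ q} → IsPerm N p → IsPerm N p′ → q ∈ ins p → q ∈ ins p′ → p ≡ p′
      sound    : ∀ {p q} → IsPerm N p → q ∈ ins p → IsPerm (suc N) q
      complete : ∀ {q} → IsPerm (suc N) q → ∃ λ p → IsPerm N p × q ∈ ins p

  Σ-insertionScheme : ∀ {N ins} → InsertionScheme N ins → ∀ f → ΣL (perms (suc N)) f ≡ ΣL (perms N) (λ p → ΣL (ins p) f)
  Σ-insertionScheme {N} {ins} scheme f =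
    trans (Σ-↭ (∼bag⇒↭ (unique∧set⇒bag (unique-perms (suc N)) unique-all (mk⇔ to from))) f) (Σ-concatMap ins (perms N) f)
    where
    open InsertionScheme scheme
    perm : ∀ {n p} → p ∈ perms n → IsPerm n p
    perm {n} = Equivalence.to (∈-perms⇔ {n})
    unique-all : Unique (concatMap ins (perms N))
    unique-all = unique-concatMap ins {perms N} (unique-perms N) (unique ∘ perm {N}) (λ p∈ p′∈ → disjoint (perm {N} p∈) (perm {N} p′∈))
    to : ∀ {q} → q ∈ perms (suc N) → q ∈ concatMap ins (perms N)
    to q∈ = let p , p-perm , q∈ins = complete (perm {suc N} q∈) in
      ∈-concatMap⁺ ins {perms N} (Any.map (λ { refl → q∈ins }) (Equivalence.from (∈-perms⇔ {N}) p-perm))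
    from : ∀ {q} → q ∈ concatMap ins (perms N) → q ∈ perms (suc N)
    from q∈ = let p , p∈ , q∈ins = find (∈-concatMap⁻ ins {perms N} q∈) in
      Equivalence.from (∈-perms⇔ {suc N}) (sound (perm {N} p∈) q∈ins)

  max∉perm : ∀ {N p} → IsPerm N p → suc N ∉ p
  max∉perm p-perm m∈ = ℕ.<-irrefl refl (proj₂ (Equivalence.to (perm-∈⇔ p-perm) m∈))

  cons-max-perm : ∀ {N p} → IsPerm N p → IsPerm (suc N) (suc N ∷ p)
  cons-max-perm {N} (mkPerm p) = mkPerm (↭-trans (↭-prep (suc N) p) (∷↭∷ʳ (suc N) (oneTo N)))

  insert-max-perm : ∀ {N} u {v} → IsPerm N (u ++ v) → IsPerm (suc N) (u ++ suc N ∷ v)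
  insert-max-perm u p-perm = mkPerm (↭-trans (shift _ u _) (↭oneTo (cons-max-perm p-perm)))

  delete-max-perm : ∀ {N} u {v} → IsPerm (suc N) (u ++ suc N ∷ v) → IsPerm N (u ++ v)
  delete-max-perm {N} u (mkPerm q) = mkPerm (↭-trans (drop-mid u (oneTo N) q) (↭-reflexive (++-identityʳ (oneTo N))))

  ++-∷ʳ : ∀ (R : List ℕ) x w → R ++ x ∷ w ≡ (R ∷ʳ x) ++ w
  ++-∷ʳ R x w = sym (++-assoc R [ x ] w)

  ∉-prefix : ∀ {m : ℕ} {p} R {x v} → m ∉ p → p ≡ R ++ x ∷ v → m ∉ R ∷ʳ x
  ∉-prefix R {x} {v} m∉p refl m∈ = m∉p (subst (_ ∈_) (sym (++-∷ʳ R x v)) (∈-++⁺ˡ m∈))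

  letterInsertions : ℕ → List ℕ → List (List ℕ)
  letterInsertions m p = (m ∷ p) ∷ mapSplits (λ R x v → R ++ x ∷ m ∷ v) p

  private
    letter-front≢slot : ∀ {m : ℕ} {p′ p R x v} → m ∉ p → p ≡ R ++ x ∷ v → m ∷ p′ ≢ R ++ x ∷ m ∷ v
    letter-front≢slot {R = R} {x} m∉p p≡ eq =
      case ++-conicalʳ R [ x ] (sym (proj₁ (split-unique [] (R ∷ʳ x) (λ ()) (∉-prefix R m∉p p≡) (trans eq (++-∷ʳ R x _))))) of λ ()

    letter-slot-injective : ∀ {m : ℕ} {p p′ R x v R′ x′ v′} → m ∉ p → m ∉ p′ → p ≡ R ++ x ∷ v → p′ ≡ R′ ++ x′ ∷ v′
      → R ++ x ∷ m ∷ v ≡ R′ ++ x′ ∷ m ∷ v′ → R ∷ʳ x ≡ R′ ∷ʳ x′ × v ≡ v′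
    letter-slot-injective {R = R} {x} {R′ = R′} {x′} m∉p m∉p′ p≡ p′≡ eq =
      split-unique (R ∷ʳ x) (R′ ∷ʳ x′) (∉-prefix R m∉p p≡) (∉-prefix R′ m∉p′ p′≡)
        (trans (sym (++-∷ʳ R x _)) (trans eq (++-∷ʳ R′ x′ _)))

  letterInsertions-scheme : ∀ N → InsertionScheme N (letterInsertions (suc N))
  letterInsertions-scheme N = record { unique = unique ; disjoint = disjoint ; sound = sound ; complete = complete }
    where
    m : ℕ
    m = suc N
    unique : ∀ {p} → IsPerm N p → Unique (letterInsertions m p)
    unique {p} p-perm =
      All.tabulate (λ q∈ eq → let R , x , v , p≡ , q≡ = ∈-mapSplits⁻ _ p q∈ in letter-front≢slot (max∉perm p-perm) p≡ (trans eq q≡))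
      AllPairs.∷ unique-mapSplits _ p (λ {R} {x} {v} {R′} p≡ p≡′ eq →
                   ∷ʳ-injectiveˡ R R′ (proj₁ (letter-slot-injective (max∉perm p-perm) (max∉perm p-perm) p≡ p≡′ eq)))
    disjoint : ∀ {p p′ q} → IsPerm N p → IsPerm N p′ → q ∈ letterInsertions m p → q ∈ letterInsertions m p′ → p ≡ p′
    disjoint _ _ (here refl) (here eq) = ∷-injectiveʳ eq
    disjoint {p′ = p′} _ p′-perm (here refl) (there q∈) =
      let R , x , v , p′≡ , q≡ = ∈-mapSplits⁻ _ p′ q∈ in contradiction q≡ (letter-front≢slot (max∉perm p′-perm) p′≡)
    disjoint {p} {p′} p-perm _ (there q∈) (here refl) =
      let R , x , v , p≡ , q≡ = ∈-mapSplits⁻ _ p q∈ in contradiction q≡ (letter-front≢slot (max∉perm p-perm) p≡)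
    disjoint {p} {p′} p-perm p′-perm (there q∈) (there q∈′) =
      let R , x , v , p≡ , q≡ = ∈-mapSplits⁻ _ p q∈
          R′ , x′ , v′ , p′≡ , q≡′ = ∈-mapSplits⁻ _ p′ q∈′
          u≡ , v≡ = letter-slot-injective (max∉perm p-perm) (max∉perm p′-perm) p≡ p′≡ (trans (sym q≡) q≡′)
      in begin
        p                 ≡⟨ trans p≡ (++-∷ʳ R x v) ⟩
        (R ∷ʳ x) ++ v     ≡⟨ cong₂ _++_ u≡ v≡ ⟩
        (R′ ∷ʳ x′) ++ v′  ≡⟨ trans p′≡ (++-∷ʳ R′ x′ v′) ⟨
        p′                ∎
      where open ≡-Reasoning
    sound : ∀ {p q} → IsPerm N p → q ∈ letterInsertions m p → IsPerm (suc N) q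
    sound p-perm (here refl) = cons-max-perm p-perm
    sound {p} p-perm (there q∈) with ∈-mapSplits⁻ _ p q∈
    ... | R , x , v , refl , refl =
      subst (IsPerm (suc N)) (sym (++-∷ʳ R x (m ∷ v))) (insert-max-perm (R ∷ʳ x) (subst (IsPerm N) (++-∷ʳ R x v) p-perm))
    complete : ∀ {q} → IsPerm (suc N) q → ∃ λ p → IsPerm N p × q ∈ letterInsertions m p
    complete q-perm with ∈-∃++ (Equivalence.from (perm-∈⇔ q-perm) (s≤s z≤n , ℕ.≤-refl))
    ... | u , v , refl with initLast u
    ...   | [] = v , delete-max-perm [] q-perm , here refl
    ...   | R ∷ʳ′ x = R ++ x ∷ v , subst (IsPerm N) (sym (++-∷ʳ R x v)) (delete-max-perm (R ∷ʳ x) q-perm) ,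
                      there (subst (_∈ mapSplits _ (R ++ x ∷ v)) (++-∷ʳ R x (m ∷ v)) (∈-mapSplits⁺ (λ R x v → R ++ x ∷ m ∷ v) R))

  -- R ++ m ∷ (v ∷ʳ x) is R ++ x ∷ v with m put into its cycle after i = |R| + 1, so that i ↦ m ↦ x
  cycleInsertions : ℕ → List ℕ → List (List ℕ)
  cycleInsertions m p = (p ∷ʳ m) ∷ mapSplits (λ R x v → R ++ m ∷ (v ∷ʳ x)) p

  private
    cycle-front≢slot : ∀ {m : ℕ} {p′ p R x v} → m ∉ p → p ≡ R ++ x ∷ v → p′ ∷ʳ m ≢ R ++ m ∷ (v ∷ʳ x)
    cycle-front≢slot {m} {p′} {R = R} {x} {v} m∉p refl eq =
      m∉p (subst (_∈ R ++ x ∷ v) (sym (∷ʳ-injectiveʳ p′ (R ++ m ∷ v) (trans eq (sym (++-assoc R (m ∷ v) [ x ]))))) (∈-insert R))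

    cycle-slot-injective : ∀ {m : ℕ} {p p′ R x v R′ x′ v′} → m ∉ p → m ∉ p′ → p ≡ R ++ x ∷ v → p′ ≡ R′ ++ x′ ∷ v′
      → R ++ m ∷ (v ∷ʳ x) ≡ R′ ++ m ∷ (v′ ∷ʳ x′) → R ≡ R′ × v ≡ v′ × x ≡ x′
    cycle-slot-injective {R = R} {x} {v} {R′} {x′} {v′} m∉p m∉p′ p≡ p′≡ eq =
      let R≡ , vx≡ = split-unique R R′ (∉-prefix R m∉p p≡ ∘ ∈-++⁺ˡ) (∉-prefix R′ m∉p′ p′≡ ∘ ∈-++⁺ˡ) eq
          v≡ , x≡ = ∷ʳ-injective v v′ vx≡
      in R≡ , v≡ , x≡

  cycleInsertions-scheme : ∀ N → InsertionScheme N (cycleInsertions (suc N))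
  cycleInsertions-scheme N = record { unique = unique ; disjoint = disjoint ; sound = sound ; complete = complete }
    where
    m : ℕ
    m = suc N
    ends-with : ∀ R x v → R ++ m ∷ (v ∷ʳ x) ≡ (R ++ m ∷ v) ∷ʳ x
    ends-with R x v = sym (++-assoc R (m ∷ v) [ x ])
    unique : ∀ {p} → IsPerm N p → Unique (cycleInsertions m p)
    unique {p} p-perm =
      All.tabulate (λ q∈ eq → let R , x , v , p≡ , q≡ = ∈-mapSplits⁻ _ p q∈ in cycle-front≢slot (max∉perm p-perm) p≡ (trans eq q≡))
      AllPairs.∷ unique-mapSplits _ p (λ p≡ p≡′ eq → proj₁ (cycle-slot-injective (max∉perm p-perm) (max∉perm p-perm) p≡ p≡′ eq))
    disjoint : ∀ {p p′ q} → IsPerm N p → IsPerm N p′ → q ∈ cycleInsertions m p → q ∈ cycleInsertions m p′ → p ≡ p′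
    disjoint {p} {p′} _ _ (here refl) (here eq) = ∷ʳ-injectiveˡ p p′ eq
    disjoint {p′ = p′} _ p′-perm (here refl) (there q∈) =
      let R , x , v , p′≡ , q≡ = ∈-mapSplits⁻ _ p′ q∈ in contradiction q≡ (cycle-front≢slot (max∉perm p′-perm) p′≡)
    disjoint {p} _ _ (there q∈) (here refl) with ∈-mapSplits⁻ _ p q∈
    disjoint {p} p-perm _ (there q∈) (here refl) | R , x , v , p≡ , q≡ = contradiction q≡ (cycle-front≢slot (max∉perm p-perm) p≡)
    disjoint {p} {p′} p-perm p′-perm (there q∈) (there q∈′) with ∈-mapSplits⁻ _ p q∈ | ∈-mapSplits⁻ _ p′ q∈′
    ... | R , x , v , refl , refl | R′ , x′ , v′ , refl , q≡′ with cycle-slot-injective (max∉perm p-perm) (max∉perm p′-perm) refl refl q≡′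
    ...   | refl , refl , refl = refl
    sound : ∀ {p q} → IsPerm N p → q ∈ cycleInsertions m p → IsPerm (suc N) q
    sound (mkPerm p) (here refl) = mkPerm (++⁺ʳ [ m ] p)
    sound {p} p-perm (there q∈) with ∈-mapSplits⁻ _ p q∈
    ... | R , x , v , refl , refl = insert-max-perm R (mkPerm (↭-trans (++⁺ˡ R (↭-sym (∷↭∷ʳ x v))) (↭oneTo p-perm)))
    complete : ∀ {q} → IsPerm (suc N) q → ∃ λ p → IsPerm N p × q ∈ cycleInsertions m p
    complete {q} q-perm with initLast q
    ... | [] = case perm-length q-perm of λ ()
    ... | q′ ∷ʳ′ z with z ℕ.≟ m
    ...   | yes refl = q′ , subst (IsPerm N) (++-identityʳ q′) (delete-max-perm q′ q-perm) , here refl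
    ...   | no z≢m with ∈-++⁻ q′ (Equivalence.from (perm-∈⇔ q-perm) (s≤s z≤n , ℕ.≤-refl))
    ...     | inj₂ (here m≡z) = contradiction (sym m≡z) z≢m
    ...     | inj₁ m∈q′ with ∈-∃++ m∈q′
    ...       | u , v , refl = u ++ z ∷ v ,
                  mkPerm (↭-trans (++⁺ˡ u (∷↭∷ʳ z v)) (↭oneTo (delete-max-perm u (subst (IsPerm (suc N)) (sym (ends-with u z v)) q-perm)))) ,
                  there (subst (_∈ mapSplits _ (u ++ z ∷ v)) (ends-with u z v) (∈-mapSplits⁺ (λ R x v → R ++ m ∷ (v ∷ʳ x)) u))

module WeightOperators where

  open import Defs using (_^_; 2ℚ)
  open import Algebra.Bundles using (CommutativeRing; CommutativeMonoid)
  open import Data.Nat as ℕ using (ℕ; zero; suc; _∸_)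
  import Data.Nat.Properties as ℕ
  open import Data.Product using (_×_; _,_)
  open import Data.Rational as ℚ using (ℚ; 0ℚ; 1ℚ; ½; _+_; _*_)
  import Data.Rational.Properties as ℚ
  open import Algebra.Properties.Semiring.Mult (CommutativeRing.semiring ℚ.+-*-commutativeRing)
    using (×-comm-*) renaming (_×_ to _·_)
  open import Algebra.Properties.CommutativeMonoid.Mult ℚ.+-0-commutativeMonoid using (×-distrib-+)
  open import Algebra.Properties.CommutativeSemigroup (CommutativeMonoid.commutativeSemigroup ℚ.+-0-commutativeMonoid)
    using (interchange)
  open import Tactic.RingSolver using (solve-∀)
  open import Tactic.RingSolver.Core.AlmostCommutativeRing using (AlmostCommutativeRing; fromCommutativeRing)
  open import Level using (0ℓ)
  open import Relation.Nullary.Decidable using (dec⇒maybe)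
  open import Relation.Binary.PropositionalEquality
  open ≡-Reasoning

  ℚ-ring : AlmostCommutativeRing 0ℓ 0ℓ
  ℚ-ring = fromCommutativeRing ℚ.+-*-commutativeRing (λ x → dec⇒maybe (0ℚ ℚ.≟ x))

  ^-distribʳ-* : ∀ q r n → (q * r) ^ n ≡ q ^ n * r ^ n
  ^-distribʳ-* q r zero    = refl
  ^-distribʳ-* q r (suc n) = trans (cong ((q * r) *_) (^-distribʳ-* q r n)) (shuffle q r (q ^ n) (r ^ n))
    where
    shuffle : ∀ a b c d → (a * b) * (c * d) ≡ (a * c) * (b * d)
    shuffle = solve-∀ ℚ-ring

  ^-homo-+ : ∀ q m n → q ^ (m ℕ.+ n) ≡ q ^ m * q ^ n
  ^-homo-+ q zero    n = sym (ℚ.*-identityˡ (q ^ n))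
  ^-homo-+ q (suc m) n = trans (cong (q *_) (^-homo-+ q m n)) (sym (ℚ.*-assoc q (q ^ m) (q ^ n)))

  -- Σ_{j+k=f} C(f,j) G j k, unfolded along the first step of a lattice path
  binomialSum : ℕ → (ℕ → ℕ → ℚ) → ℚ
  binomialSum zero    G = G 0 0
  binomialSum (suc f) G = binomialSum f (λ j k → G (suc j) k) + binomialSum f (λ j k → G j (suc k))

  binomialSum-cong : ∀ f {G H} → (∀ j k → G j k ≡ H j k) → binomialSum f G ≡ binomialSum f H
  binomialSum-cong zero    G≡H = G≡H 0 0
  binomialSum-cong (suc f) G≡H =
    cong₂ _+_ (binomialSum-cong f (λ j k → G≡H (suc j) k)) (binomialSum-cong f (λ j k → G≡H j (suc k)))

  binomialSum-+ : ∀ f (G H : ℕ → ℕ → ℚ) → binomialSum f (λ j k → G j k + H j k) ≡ binomialSum f G + binomialSum f H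
  binomialSum-+ zero    G H = refl
  binomialSum-+ (suc f) G H = begin
    binomialSum f (λ j k → G (suc j) k + H (suc j) k) + binomialSum f (λ j k → G j (suc k) + H j (suc k))
      ≡⟨ cong₂ _+_ (binomialSum-+ f (λ j k → G (suc j) k) (λ j k → H (suc j) k))
                   (binomialSum-+ f (λ j k → G j (suc k)) (λ j k → H j (suc k))) ⟩
    (binomialSum f (λ j k → G (suc j) k) + binomialSum f (λ j k → H (suc j) k))
      + (binomialSum f (λ j k → G j (suc k)) + binomialSum f (λ j k → H j (suc k)))
      ≡⟨ interchange (binomialSum f (λ j k → G (suc j) k)) (binomialSum f (λ j k → H (suc j) k))
                     (binomialSum f (λ j k → G j (suc k))) (binomialSum f (λ j k → H j (suc k))) ⟩
    binomialSum (suc f) G + binomialSum (suc f) H ∎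

  binomialSum-· : ∀ f n (G : ℕ → ℕ → ℚ) → binomialSum f (λ j k → n · G j k) ≡ n · binomialSum f G
  binomialSum-· f zero    G = zeros f
    where
    zeros : ∀ f → binomialSum f (λ _ _ → 0ℚ) ≡ 0ℚ
    zeros zero    = refl
    zeros (suc f) = cong₂ _+_ (zeros f) (zeros f)
  binomialSum-· f (suc n) G = trans (binomialSum-+ f G (λ j k → n · G j k)) (cong (binomialSum f G +_) (binomialSum-· f n G))

  private
    ·-unfold : ∀ f G → f · (binomialSum (f ∸ 1) (λ j k → G (suc j) k) + binomialSum (f ∸ 1) (λ j k → G j (suc k)))
                       ≡ f · binomialSum f G
    ·-unfold zero    G = refl
    ·-unfold (suc f) G = refl

  -- j C(f,j) = f C(f-1,j-1)
  binomialSum-·ˡ : ∀ f (H : ℕ → ℕ → ℚ) → binomialSum f (λ j k → j · H j k) ≡ f · binomialSum (f ∸ 1) (λ j k → H (suc j) k)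
  binomialSum-·ˡ zero    H = refl
  binomialSum-·ˡ (suc f) H = begin
    binomialSum f (λ j k → H (suc j) k + j · H (suc j) k) + binomialSum f (λ j k → j · H j (suc k))
      ≡⟨ cong (_+ binomialSum f (λ j k → j · H j (suc k))) (binomialSum-+ f (λ j k → H (suc j) k) (λ j k → j · H (suc j) k)) ⟩
    (X + binomialSum f (λ j k → j · H (suc j) k)) + binomialSum f (λ j k → j · H j (suc k))
      ≡⟨ cong₂ (λ a b → (X + a) + b) (binomialSum-·ˡ f (λ j k → H (suc j) k)) (binomialSum-·ˡ f (λ j k → H j (suc k))) ⟩
    (X + f · Y) + f · Z
      ≡⟨ trans (ℚ.+-assoc X _ _) (cong (X +_) (sym (×-distrib-+ Y Z f))) ⟩
    X + f · (Y + Z)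
      ≡⟨ cong (X +_) (·-unfold f (λ j k → H (suc j) k)) ⟩
    X + f · X ∎
    where
    X Y Z : ℚ
    X = binomialSum f (λ j k → H (suc j) k)
    Y = binomialSum (f ∸ 1) (λ j k → H (suc (suc j)) k)
    Z = binomialSum (f ∸ 1) (λ j k → H (suc j) (suc k))

  binomialSum-·ʳ : ∀ f (H : ℕ → ℕ → ℚ) → binomialSum f (λ j k → k · H j k) ≡ f · binomialSum (f ∸ 1) (λ j k → H j (suc k))
  binomialSum-·ʳ zero    H = refl
  binomialSum-·ʳ (suc f) H = begin
    binomialSum f (λ j k → k · H (suc j) k) + binomialSum f (λ j k → H j (suc k) + k · H j (suc k))
      ≡⟨ cong (binomialSum f (λ j k → k · H (suc j) k) +_) (binomialSum-+ f (λ j k → H j (suc k)) (λ j k → k · H j (suc k))) ⟩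
    binomialSum f (λ j k → k · H (suc j) k) + (X + binomialSum f (λ j k → k · H j (suc k)))
      ≡⟨ cong₂ (λ a b → a + (X + b)) (binomialSum-·ʳ f (λ j k → H (suc j) k)) (binomialSum-·ʳ f (λ j k → H j (suc k))) ⟩
    f · Y + (X + f · Z)
      ≡⟨ swap (f · Y) X (f · Z) ⟩
    X + (f · Y + f · Z)
      ≡⟨ cong (X +_) (trans (sym (×-distrib-+ Y Z f)) (·-unfold f (λ j k → H j (suc k)))) ⟩
    X + f · X ∎
    where
    X Y Z : ℚ
    X = binomialSum f (λ j k → H j (suc k))
    Y = binomialSum (f ∸ 1) (λ j k → H (suc j) (suc k))
    Z = binomialSum (f ∸ 1) (λ j k → H j (suc (suc k)))
    swap : ∀ a b c → a + (b + c) ≡ b + (a + c)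
    swap = solve-∀ ℚ-ring

  binomial-theorem : ∀ s t f A → binomialSum f (λ j k → (A * s ^ j) * t ^ k) ≡ A * (s + t) ^ f
  binomial-theorem s t zero    A = ℚ.*-identityʳ (A * 1ℚ)
  binomial-theorem s t (suc f) A = begin
    binomialSum f (λ j k → (A * (s * s ^ j)) * t ^ k) + binomialSum f (λ j k → (A * s ^ j) * (t * t ^ k))
      ≡⟨ cong₂ _+_ (binomialSum-cong f (λ j k → cong (_* t ^ k) (sym (ℚ.*-assoc A s (s ^ j)))))
                   (binomialSum-cong f (λ j k → regroup A (s ^ j) t (t ^ k))) ⟩
    binomialSum f (λ j k → ((A * s) * s ^ j) * t ^ k) + binomialSum f (λ j k → ((A * t) * s ^ j) * t ^ k)
      ≡⟨ cong₂ _+_ (binomial-theorem s t f (A * s)) (binomial-theorem s t f (A * t)) ⟩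
    (A * s) * (s + t) ^ f + (A * t) * (s + t) ^ f
      ≡⟨ collect A s t ((s + t) ^ f) ⟩
    A * (s + t) ^ suc f ∎
    where
    regroup : ∀ a u t v → (a * u) * (t * v) ≡ ((a * t) * u) * v
    regroup = solve-∀ ℚ-ring
    collect : ∀ a s t p → (a * s) * p + (a * t) * p ≡ a * ((s + t) * p)
    collect = solve-∀ ℚ-ring

  Stats : Set
  Stats = ℕ × ℕ × ℕ × ℕ

  stats≡ : ∀ {a b c d a′ b′ c′ d′ : ℕ} → a ≡ a′ → b ≡ b′ → c ≡ c′ → d ≡ d′ → _≡_ {A = Stats} (a , b , c , d) (a′ , b′ , c′ , d′)
  stats≡ refl refl refl refl = refl

  -- Inserting n+2 into the one-line notation of a permutation of [n+1] with statistics (basc, des - plrmin, suc, plrmin)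
  letterStep : (Stats → ℚ) → Stats → ℚ
  letterStep g (a , b , c , d) =
    g (a , b , c , suc d) + (g (a , b , suc c , d) + (c · g (suc a , suc b , c ∸ 1 , d)
      + (a · g (a , suc b , c , d) + (d · g (suc a , suc b , c , d ∸ 1) + b · g (suc a , b , c , d)))))

  -- Inserting n+1 into the cycles of a permutation of [n] with statistics (exc, drop, fix, cyc)
  cycleStep : (Stats → ℚ) → Stats → ℚ
  cycleStep h (e , d , f , c) =
    h (e , d , suc f , suc c) + (e · h (e , suc d , f , c) + (d · h (suc e , d , f , c) + f · h (suc e , suc d , f ∸ 1 , c)))

  transfer : (Stats → ℚ) → Stats → ℚ
  transfer g (e , d , f , c) = (2ℚ ^ c * ½ ^ f) * binomialSum f (λ j k → g (e , d , j , k))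

  binomialSum-letterStep : ∀ g e d f →
    binomialSum f (λ j k → letterStep g (e , d , j , k))
    ≡ binomialSum (suc f) (λ j k → g (e , d , j , k))
      + (e · binomialSum f (λ j k → g (e , suc d , j , k)) + (d · binomialSum f (λ j k → g (suc e , d , j , k))
      + (f · binomialSum (f ∸ 1) (λ j k → g (suc e , suc d , j , k))
         + f · binomialSum (f ∸ 1) (λ j k → g (suc e , suc d , j , k)))))
  binomialSum-letterStep g e d f = begin
    binomialSum f (λ j k → G j (suc k) + (G (suc j) k + (j · H (j ∸ 1) k
      + (e · g (e , suc d , j , k) + (k · H j (k ∸ 1) + d · g (suc e , d , j , k))))))
      ≡⟨ binomialSum-+ f (λ j k → G j (suc k)) _ ⟩
    X₁ + binomialSum f (λ j k → G (suc j) k + (j · H (j ∸ 1) k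
      + (e · g (e , suc d , j , k) + (k · H j (k ∸ 1) + d · g (suc e , d , j , k)))))
      ≡⟨ cong (X₁ +_) (binomialSum-+ f (λ j k → G (suc j) k) _) ⟩
    X₁ + (X₂ + binomialSum f (λ j k → j · H (j ∸ 1) k
      + (e · g (e , suc d , j , k) + (k · H j (k ∸ 1) + d · g (suc e , d , j , k)))))
      ≡⟨ cong (λ z → X₁ + (X₂ + z)) (binomialSum-+ f (λ j k → j · H (j ∸ 1) k) _) ⟩
    X₁ + (X₂ + (binomialSum f (λ j k → j · H (j ∸ 1) k)
      + binomialSum f (λ j k → e · g (e , suc d , j , k) + (k · H j (k ∸ 1) + d · g (suc e , d , j , k)))))
      ≡⟨ cong (λ z → X₁ + (X₂ + (binomialSum f (λ j k → j · H (j ∸ 1) k) + z)))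
              (binomialSum-+ f (λ j k → e · g (e , suc d , j , k)) _) ⟩
    X₁ + (X₂ + (binomialSum f (λ j k → j · H (j ∸ 1) k) + (binomialSum f (λ j k → e · g (e , suc d , j , k))
      + binomialSum f (λ j k → k · H j (k ∸ 1) + d · g (suc e , d , j , k)))))
      ≡⟨ cong (λ z → X₁ + (X₂ + (binomialSum f (λ j k → j · H (j ∸ 1) k) + (binomialSum f (λ j k → e · g (e , suc d , j , k)) + z))))
              (binomialSum-+ f (λ j k → k · H j (k ∸ 1)) _) ⟩
    X₁ + (X₂ + (binomialSum f (λ j k → j · H (j ∸ 1) k) + (binomialSum f (λ j k → e · g (e , suc d , j , k))
      + (binomialSum f (λ j k → k · H j (k ∸ 1)) + binomialSum f (λ j k → d · g (suc e , d , j , k))))))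
      ≡⟨ cong₂ (λ u v → X₁ + (X₂ + (u + v))) (binomialSum-·ˡ f (λ j k → H (j ∸ 1) k))
          (cong₂ _+_ (binomialSum-· f e _) (cong₂ _+_ (binomialSum-·ʳ f (λ j k → H j (k ∸ 1))) (binomialSum-· f d _))) ⟩
    X₁ + (X₂ + (f · Z + (e · Y₁ + (f · Z + d · Y₂))))
      ≡⟨ regroup X₁ X₂ (f · Z) (e · Y₁) (d · Y₂) ⟩
    (X₂ + X₁) + (e · Y₁ + (d · Y₂ + (f · Z + f · Z))) ∎
    where
    G H : ℕ → ℕ → ℚ
    G j k = g (e , d , j , k)
    H j k = g (suc e , suc d , j , k)
    X₁ X₂ Y₁ Y₂ Z : ℚ
    X₁ = binomialSum f (λ j k → G j (suc k))
    X₂ = binomialSum f (λ j k → G (suc j) k)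
    Y₁ = binomialSum f (λ j k → g (e , suc d , j , k))
    Y₂ = binomialSum f (λ j k → g (suc e , d , j , k))
    Z = binomialSum (f ∸ 1) (λ j k → H j k)
    regroup : ∀ x₁ x₂ z y₁ y₂ → x₁ + (x₂ + (z + (y₁ + (z + y₂)))) ≡ (x₂ + x₁) + (y₁ + (y₂ + (z + z)))
    regroup = solve-∀ ℚ-ring

  halve : ∀ f P Z → (P * ½ ^ f) * (f · Z + f · Z) ≡ f · ((P * ½ ^ (f ∸ 1)) * Z)
  halve zero    P Z = ℚ.*-zeroʳ (P * 1ℚ)
  halve (suc f) P Z = begin
    (P * (½ * ½ ^ f)) * (suc f · Z + suc f · Z)  ≡⟨ cong ((P * (½ * ½ ^ f)) *_) (×-distrib-+ Z Z (suc f)) ⟨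
    (P * (½ * ½ ^ f)) * (suc f · (Z + Z))        ≡⟨ ×-comm-* (suc f) (P * (½ * ½ ^ f)) (Z + Z) ⟩
    suc f · ((P * (½ * ½ ^ f)) * (Z + Z))        ≡⟨ cong (suc f ·_) (regroup P ½ (½ ^ f) Z) ⟩
    suc f · (((P * ½ ^ f) * Z) * (½ + ½))        ≡⟨ cong (suc f ·_) (ℚ.*-identityʳ ((P * ½ ^ f) * Z)) ⟩
    suc f · ((P * ½ ^ f) * Z)                    ∎
    where
    regroup : ∀ p h q z → (p * (h * q)) * (z + z) ≡ ((p * q) * z) * (h + h)
    regroup = solve-∀ ℚ-ring

  transfer-letterStep : ∀ g t → transfer (letterStep g) t ≡ cycleStep (transfer g) t
  transfer-letterStep g (e , d , f , c) = begin
    K * binomialSum f (λ j k → letterStep g (e , d , j , k))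
      ≡⟨ cong (K *_) (binomialSum-letterStep g e d f) ⟩
    K * (B + (e · Y₁ + (d · Y₂ + (f · Z + f · Z))))
      ≡⟨ distrib K B (e · Y₁) (d · Y₂) (f · Z + f · Z) ⟩
    K * B + (K * (e · Y₁) + (K * (d · Y₂) + K * (f · Z + f · Z)))
      ≡⟨ cong₂ _+_ (cong (_* B) doubling) (cong₂ _+_ (×-comm-* e K Y₁) (cong₂ _+_ (×-comm-* d K Y₂) (halve f (2ℚ ^ c) Z))) ⟩
    cycleStep (transfer g) (e , d , f , c) ∎
    where
    K B Y₁ Y₂ Z : ℚ
    K = 2ℚ ^ c * ½ ^ f
    B = binomialSum (suc f) (λ j k → g (e , d , j , k))
    Y₁ = binomialSum f (λ j k → g (e , suc d , j , k))
    Y₂ = binomialSum f (λ j k → g (suc e , d , j , k))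
    Z = binomialSum (f ∸ 1) (λ j k → g (suc e , suc d , j , k))
    distrib : ∀ k b y₁ y₂ z → k * (b + (y₁ + (y₂ + z))) ≡ k * b + (k * y₁ + (k * y₂ + k * z))
    distrib = solve-∀ ℚ-ring
    doubling : K ≡ (2ℚ * 2ℚ ^ c) * (½ * ½ ^ f)
    doubling = sym (trans (regroup 2ℚ ½ (2ℚ ^ c) (½ ^ f)) (ℚ.*-identityˡ K))
      where
      regroup : ∀ a b p q → (a * p) * (b * q) ≡ (a * b) * (p * q)
      regroup = solve-∀ ℚ-ring

  weight : ℚ → ℚ → ℚ → ℚ → Stats → ℚ
  weight x y s t (a , b , c , d) = ((x ^ a * y ^ b) * s ^ c) * t ^ d

  transfer-weight : ∀ x y s t e d f c →
    transfer (weight x y s t) (e , d , f , c) ≡ ((x ^ e * y ^ d) * ((t + s) * ½) ^ f) * 2ℚ ^ c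
  transfer-weight x y s t e d f c = begin
    (2ℚ ^ c * ½ ^ f) * binomialSum f (λ j k → ((x ^ e * y ^ d) * s ^ j) * t ^ k)
      ≡⟨ cong ((2ℚ ^ c * ½ ^ f) *_) (binomial-theorem s t f (x ^ e * y ^ d)) ⟩
    (2ℚ ^ c * ½ ^ f) * ((x ^ e * y ^ d) * (s + t) ^ f)
      ≡⟨ cong (λ u → (2ℚ ^ c * ½ ^ f) * ((x ^ e * y ^ d) * u ^ f)) (ℚ.+-comm s t) ⟩
    (2ℚ ^ c * ½ ^ f) * ((x ^ e * y ^ d) * (t + s) ^ f)
      ≡⟨ regroup (2ℚ ^ c) (½ ^ f) (x ^ e * y ^ d) ((t + s) ^ f) ⟩
    ((x ^ e * y ^ d) * ((t + s) ^ f * ½ ^ f)) * 2ℚ ^ c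
      ≡⟨ cong (λ u → ((x ^ e * y ^ d) * u) * 2ℚ ^ c) (^-distribʳ-* (t + s) ½ f) ⟨
    ((x ^ e * y ^ d) * ((t + s) * ½) ^ f) * 2ℚ ^ c ∎
    where
    regroup : ∀ c h a u → (c * h) * (a * u) ≡ (a * (u * h)) * c
    regroup = solve-∀ ℚ-ring

  weight-diagonal : ∀ x y s {a c d l} → l ℕ.≤ d → (x ^ a * y ^ d) * s ^ c ≡ weight x y s y (a , d ∸ l , c , l)
  weight-diagonal x y s {a} {c} {d} {l} l≤d = begin
    (x ^ a * y ^ d) * s ^ c                        ≡⟨ cong (λ k → (x ^ a * y ^ k) * s ^ c) (ℕ.m∸n+n≡m l≤d) ⟨
    (x ^ a * y ^ (d ∸ l ℕ.+ l)) * s ^ c            ≡⟨ cong (λ u → (x ^ a * u) * s ^ c) (^-homo-+ y (d ∸ l) l) ⟩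
    (x ^ a * (y ^ (d ∸ l) * y ^ l)) * s ^ c        ≡⟨ regroup (x ^ a) (y ^ (d ∸ l)) (y ^ l) (s ^ c) ⟩
    ((x ^ a * y ^ (d ∸ l)) * s ^ c) * y ^ l        ∎
    where
    regroup : ∀ a b c d → (a * (b * c)) * d ≡ ((a * b) * d) * c
    regroup = solve-∀ ℚ-ring

module LocalStatistics where

  open Permutations
  open import Defs
  open import Function using (_∘_; Equivalence; case_of_)
  open import Algebra.Bundles using (CommutativeRing)
  open import Data.Bool using (Bool; true; false; T; _∧_; _∨_; not)
  open import Data.Bool.Properties using (T-≡; ∨-identityˡ; ∨-identityʳ; ∨-assoc; ∧-zeroʳ; ∧-identityʳ; ∧-assoc)
  open import Data.Bool.ListAction using (all; any; and)
  open import Data.Nat as ℕ using (ℕ; zero; suc; _+_; _∸_; _≤_; _<_; z≤n; s≤s; _≡ᵇ_; _<ᵇ_)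
  import Data.Nat.Properties as ℕ
  open import Data.Nat.Properties using (<ᵇ-reflects-<; ≡ᵇ⇒≡; ≡⇒≡ᵇ; <⇒<ᵇ)
  open import Data.Nat.ListAction using (sum)
  open import Data.Nat.ListAction.Properties using (sum-++)
  open import Data.Product using (proj₁)
  open import Data.List as List using (List; []; _∷_; _++_; _∷ʳ_; [_]; length; take; map; applyUpTo)
  open import Data.List.Properties using (map-++; map-∘; map-applyUpTo; length-++; length-take; ++-assoc; ++-identityʳ)
  open import Data.List.Membership.Propositional using (_∈_; _∉_)
  open import Data.List.Relation.Unary.Any using (here; there)
  import Data.List.Relation.Unary.All as All
  import Data.List.Relation.Unary.AllPairs as AllPairs
  open import Data.List.Relation.Unary.Unique.Propositional using (Unique)
  open import Data.Rational as ℚ using (ℚ; 0ℚ)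
  import Data.Rational.Properties as ℚ
  open import Algebra.Properties.Semiring.Mult (CommutativeRing.semiring ℚ.+-*-commutativeRing)
    using (×-homo-+) renaming (_×_ to _·_)
  open import Algebra.Properties.CommutativeSemigroup ℕ.+-commutativeSemigroup using (interchange)
  open import Data.Nat.Tactic.RingSolver using (solve-∀)
  open import Relation.Nullary using (contradiction; yes; no)
  open import Relation.Nullary.Reflects using (ofʸ)
  open import Relation.Binary.PropositionalEquality hiding ([_])
  open ≡-Reasoning

  ⟦_⟧ : Bool → ℕ
  ⟦ true ⟧  = 1
  ⟦ false ⟧ = 0

  count≡sum : ∀ (p : ℕ → Bool) xs → count p xs ≡ sum (map (⟦_⟧ ∘ p) xs)
  count≡sum p []       = refl
  count≡sum p (x ∷ xs) with p x
  ... | true  = cong suc (count≡sum p xs)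
  ... | false = count≡sum p xs

  count-oneTo : ∀ (p : ℕ → Bool) n → count p (oneTo n) ≡ sum (applyUpTo (λ j → ⟦ p (suc j) ⟧) n)
  count-oneTo p n = begin
    count p (oneTo n)                      ≡⟨ count≡sum p (oneTo n) ⟩
    sum (map (⟦_⟧ ∘ p) (oneTo n))          ≡⟨ cong (sum ∘ map (⟦_⟧ ∘ p)) (oneTo≡applyUpTo n) ⟩
    sum (map (⟦_⟧ ∘ p) (applyUpTo suc n))  ≡⟨ cong sum (map-applyUpTo suc (⟦_⟧ ∘ p) n) ⟩
    sum (applyUpTo (λ j → ⟦ p (suc j) ⟧) n) ∎

  next : List ℕ → ℕ
  next []      = 0
  next (b ∷ _) = b

  LocalTest : Set
  LocalTest = List ℕ → ℕ → ℕ → Bool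

  countLocal : LocalTest → List ℕ → ℕ
  countLocal G w = sum (mapSplits (λ R a v → ⟦ G R a (next v) ⟧) w)

  countPositions : (ℕ → ℕ → Bool) → List ℕ → ℕ
  countPositions T w = sum (mapSplits (λ R a _ → ⟦ T (suc (length R)) a ⟧) w)

  mapSplits-cong : ∀ {A : Set} {f g : List ℕ → ℕ → List ℕ → A} w
    → (∀ R a v → w ≡ R ++ a ∷ v → f R a v ≡ g R a v) → mapSplits f w ≡ mapSplits g w
  mapSplits-cong []      _   = refl
  mapSplits-cong (a ∷ w) f≡g = cong₂ _∷_ (f≡g [] a w refl) (mapSplits-cong w (λ R b v e → f≡g (a ∷ R) b v (cong (a ∷_) e)))

  mapSplits-++-∷ : ∀ {A : Set} (f : List ℕ → ℕ → List ℕ → A) u a w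
    → mapSplits f (u ++ a ∷ w) ≡ mapSplits (λ R b v → f R b (v ++ a ∷ w)) u ++ f u a w ∷ mapSplits (λ R → f (u ++ a ∷ R)) w
  mapSplits-++-∷ f []      a w = refl
  mapSplits-++-∷ f (b ∷ u) a w = cong (f [] b (u ++ a ∷ w) ∷_) (mapSplits-++-∷ (λ R → f (b ∷ R)) u a w)

  mapSplits≡applyUpTo : ∀ {A : Set} (f : List ℕ → ℕ → List ℕ → A) w
    → mapSplits f w ≡ applyUpTo (λ j → f (take j w) (at w (suc j)) (List.drop (suc j) w)) (length w)
  mapSplits≡applyUpTo f []      = refl
  mapSplits≡applyUpTo f (a ∷ w) = cong (f [] a w ∷_) (mapSplits≡applyUpTo (λ R → f (a ∷ R)) w)

  applyUpTo-cong : ∀ {A : Set} {f g : ℕ → A} n → (∀ {j} → j < n → f j ≡ g j) → applyUpTo f n ≡ applyUpTo g n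
  applyUpTo-cong zero    _   = refl
  applyUpTo-cong (suc n) f≡g = cong₂ _∷_ (f≡g (s≤s z≤n)) (applyUpTo-cong n (f≡g ∘ s≤s))

  next-drop : ∀ j w → next (List.drop j w) ≡ at w (suc j)
  next-drop zero    []          = refl
  next-drop (suc j) []          = refl
  next-drop zero    (a ∷ w)     = refl
  next-drop (suc j) (a ∷ [])    = next-drop j []
  next-drop (suc j) (a ∷ b ∷ w) = next-drop j (b ∷ w)

  countLocal≡count : ∀ G w → countLocal G w ≡ count (λ i → G (take (i ∸ 1) w) (at w i) (at w (suc i))) (oneTo (length w))
  countLocal≡count G w = begin
    sum (mapSplits (λ R a v → ⟦ G R a (next v) ⟧) w)
      ≡⟨ cong sum (mapSplits≡applyUpTo _ w) ⟩
    sum (applyUpTo (λ j → ⟦ G (take j w) (at w (suc j)) (next (List.drop (suc j) w)) ⟧) (length w))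
      ≡⟨ cong sum (applyUpTo-cong (length w) (λ {j} _ → cong (λ y → ⟦ G (take j w) (at w (suc j)) y ⟧) (next-drop (suc j) w))) ⟩
    sum (applyUpTo (λ j → ⟦ G (take j w) (at w (suc j)) (at w (suc (suc j))) ⟧) (length w))
      ≡⟨ count-oneTo _ (length w) ⟨
    count (λ i → G (take (i ∸ 1) w) (at w i) (at w (suc i))) (oneTo (length w)) ∎

  countPositions≡count : ∀ T w → countPositions T w ≡ count (λ i → T i (at w i)) (oneTo (length w))
  countPositions≡count T w = begin
    sum (mapSplits (λ R a _ → ⟦ T (suc (length R)) a ⟧) w)
      ≡⟨ cong sum (mapSplits≡applyUpTo _ w) ⟩
    sum (applyUpTo (λ j → ⟦ T (suc (length (take j w))) (at w (suc j)) ⟧) (length w))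
      ≡⟨ cong sum (applyUpTo-cong (length w) (λ {j} j<n → cong (λ i → ⟦ T (suc i) (at w (suc j)) ⟧)
                    (trans (length-take j w) (ℕ.m≤n⇒m⊓n≡m (ℕ.<⇒≤ j<n))))) ⟩
    sum (applyUpTo (λ j → ⟦ T (suc j) (at w (suc j)) ⟧) (length w))
      ≡⟨ count-oneTo _ (length w) ⟨
    count (λ i → T i (at w i)) (oneTo (length w)) ∎

  private
    next-++-∷ : ∀ v x w w′ → next (v ++ x ∷ w) ≡ next (v ++ x ∷ w′)
    next-++-∷ []      x w w′ = refl
    next-++-∷ (b ∷ v) x w w′ = refl

  countLocal-insert : ∀ G R x m v
    → countLocal (λ R′ → G (R ++ x ∷ m ∷ R′)) v ≡ countLocal (λ R′ → G (R ++ x ∷ R′)) v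
    → countLocal G (R ++ x ∷ m ∷ v) + ⟦ G R x (next v) ⟧
      ≡ countLocal G (R ++ x ∷ v) + (⟦ G R x m ⟧ + ⟦ G (R ∷ʳ x) m (next v) ⟧)
  countLocal-insert G R x m v tail≡ = begin
    sum (mapSplits F (R ++ x ∷ m ∷ v)) + ⟦ G R x (next v) ⟧
      ≡⟨ cong (λ l → sum l + ⟦ G R x (next v) ⟧) (mapSplits-++-∷ F R x (m ∷ v)) ⟩
    sum (before (m ∷ v) ++ ⟦ G R x m ⟧ ∷ ⟦ G (R ∷ʳ x) m (next v) ⟧ ∷ mapSplits (λ R′ → F (R ++ x ∷ m ∷ R′)) v)
      + ⟦ G R x (next v) ⟧
      ≡⟨ cong (_+ ⟦ G R x (next v) ⟧) (sum-++ (before (m ∷ v)) _) ⟩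
    (sum (before (m ∷ v)) + (⟦ G R x m ⟧ + (⟦ G (R ∷ʳ x) m (next v) ⟧ + countLocal (λ R′ → G (R ++ x ∷ m ∷ R′)) v)))
      + ⟦ G R x (next v) ⟧
      ≡⟨ cong₂ (λ a t → (a + (⟦ G R x m ⟧ + (⟦ G (R ∷ʳ x) m (next v) ⟧ + t))) + ⟦ G R x (next v) ⟧)
               (cong sum (mapSplits-cong R (λ R′ b v′ _ → cong (⟦_⟧ ∘ G R′ b) (next-++-∷ v′ x (m ∷ v) v)))) tail≡ ⟩
    (sum (before v) + (⟦ G R x m ⟧ + (⟦ G (R ∷ʳ x) m (next v) ⟧ + countLocal (λ R′ → G (R ++ x ∷ R′)) v)))
      + ⟦ G R x (next v) ⟧
      ≡⟨ rearrange (sum (before v)) ⟦ G R x m ⟧ ⟦ G (R ∷ʳ x) m (next v) ⟧ _ ⟦ G R x (next v) ⟧ ⟩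
    (sum (before v) + (⟦ G R x (next v) ⟧ + countLocal (λ R′ → G (R ++ x ∷ R′)) v)) + (⟦ G R x m ⟧ + ⟦ G (R ∷ʳ x) m (next v) ⟧)
      ≡⟨ cong (_+ (⟦ G R x m ⟧ + ⟦ G (R ∷ʳ x) m (next v) ⟧)) (sum-++ (before v) _) ⟨
    sum (before v ++ ⟦ G R x (next v) ⟧ ∷ mapSplits (λ R′ → F (R ++ x ∷ R′)) v) + (⟦ G R x m ⟧ + ⟦ G (R ∷ʳ x) m (next v) ⟧)
      ≡⟨ cong (λ l → sum l + (⟦ G R x m ⟧ + ⟦ G (R ∷ʳ x) m (next v) ⟧)) (mapSplits-++-∷ F R x v) ⟨
    sum (mapSplits F (R ++ x ∷ v)) + (⟦ G R x m ⟧ + ⟦ G (R ∷ʳ x) m (next v) ⟧) ∎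
    where
    F : List ℕ → ℕ → List ℕ → ℕ
    F R a v = ⟦ G R a (next v) ⟧
    before : List ℕ → List ℕ
    before w = mapSplits (λ R′ b v′ → F R′ b (v′ ++ x ∷ w)) R
    rearrange : ∀ a b c t d → (a + (b + (c + t))) + d ≡ (a + (d + t)) + (b + c)
    rearrange = solve-∀

  countPositions-insert : ∀ T R x m v
    → countPositions T (R ++ m ∷ (v ∷ʳ x)) + ⟦ T (suc (length R)) x ⟧
      ≡ countPositions T (R ++ x ∷ v) + (⟦ T (suc (length R)) m ⟧ + ⟦ T (suc (length (R ++ m ∷ v))) x ⟧)
  countPositions-insert T R x m v = begin
    sum (mapSplits F (R ++ m ∷ (v ∷ʳ x))) + ⟦ T i x ⟧
      ≡⟨ cong (λ l → sum l + ⟦ T i x ⟧) (mapSplits-++-∷ F R m (v ∷ʳ x)) ⟩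
    sum (before ++ ⟦ T i m ⟧ ∷ mapSplits (λ R′ → F (R ++ m ∷ R′)) (v ++ x ∷ [])) + ⟦ T i x ⟧
      ≡⟨ cong (_+ ⟦ T i x ⟧) (sum-++ before _) ⟩
    (sum before + (⟦ T i m ⟧ + sum (mapSplits (λ R′ → F (R ++ m ∷ R′)) (v ++ x ∷ [])))) + ⟦ T i x ⟧
      ≡⟨ cong (λ l → (sum before + (⟦ T i m ⟧ + sum l)) + ⟦ T i x ⟧) (mapSplits-++-∷ (λ R′ → F (R ++ m ∷ R′)) v x []) ⟩
    (sum before + (⟦ T i m ⟧ + sum (mapSplits (λ R′ → F (R ++ m ∷ R′)) v ++ ⟦ T j x ⟧ ∷ []))) + ⟦ T i x ⟧
      ≡⟨ cong (λ t → (sum before + (⟦ T i m ⟧ + t)) + ⟦ T i x ⟧) (sum-++ (mapSplits (λ R′ → F (R ++ m ∷ R′)) v) _) ⟩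
    (sum before + (⟦ T i m ⟧ + (sum (mapSplits (λ R′ → F (R ++ m ∷ R′)) v) + (⟦ T j x ⟧ + 0)))) + ⟦ T i x ⟧
      ≡⟨ cong (λ t → (sum before + (⟦ T i m ⟧ + (t + (⟦ T j x ⟧ + 0)))) + ⟦ T i x ⟧) (cong sum
           (mapSplits-cong v (λ R′ b _ _ → cong (λ l → ⟦ T (suc l) b ⟧) (trans (length-++ R) (sym (length-++ R)))))) ⟩
    (sum before + (⟦ T i m ⟧ + (sum (mapSplits (λ R′ → F (R ++ x ∷ R′)) v) + (⟦ T j x ⟧ + 0)))) + ⟦ T i x ⟧
      ≡⟨ rearrange (sum before) ⟦ T i m ⟧ _ ⟦ T j x ⟧ ⟦ T i x ⟧ ⟩
    (sum before + (⟦ T i x ⟧ + sum (mapSplits (λ R′ → F (R ++ x ∷ R′)) v))) + (⟦ T i m ⟧ + ⟦ T j x ⟧)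
      ≡⟨ cong (_+ (⟦ T i m ⟧ + ⟦ T j x ⟧)) (trans (cong sum (mapSplits-++-∷ F R x v)) (sum-++ before _)) ⟨
    sum (mapSplits F (R ++ x ∷ v)) + (⟦ T i m ⟧ + ⟦ T j x ⟧) ∎
    where
    F : List ℕ → ℕ → List ℕ → ℕ
    F R a _ = ⟦ T (suc (length R)) a ⟧
    i j : ℕ
    i = suc (length R)
    j = suc (length (R ++ m ∷ v))
    before = mapSplits (λ R′ b _ → F R′ b []) R
    rearrange : ∀ a b t c d → (a + (b + (t + (c + 0)))) + d ≡ (a + (d + t)) + (b + c)
    rearrange = solve-∀

  map-mapSplits : ∀ {A B : Set} (g : A → B) (f : List ℕ → ℕ → List ℕ → A) w
    → List.map g (mapSplits f w) ≡ mapSplits (λ R a v → g (f R a v)) w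
  map-mapSplits g f []      = refl
  map-mapSplits g f (a ∷ w) = cong (g (f [] a w) ∷_) (map-mapSplits g (λ R → f (a ∷ R)) w)

  Σ-mapSplits : ∀ {A B : Set} {f : List ℕ → ℕ → List ℕ → A} {f′ : List ℕ → ℕ → List ℕ → B} {h h′} w
    → (∀ R a v → w ≡ R ++ a ∷ v → h (f R a v) ≡ h′ (f′ R a v)) → ΣL (mapSplits f w) h ≡ ΣL (mapSplits f′ w) h′
  Σ-mapSplits []      _    = refl
  Σ-mapSplits {f = f} {f′} {h} {h′} (a ∷ w) h≡h′ =
    cong₂ ℚ._+_ (h≡h′ [] a w refl)
      (Σ-mapSplits {f = λ R → f (a ∷ R)} {λ R → f′ (a ∷ R)} {h} {h′} w (λ R b v e → h≡h′ (a ∷ R) b v (cong (a ∷_) e)))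

  countLocal-cong : ∀ {G H} w → (∀ R a v → w ≡ R ++ a ∷ v → G R a (next v) ≡ H R a (next v)) → countLocal G w ≡ countLocal H w
  countLocal-cong w G≡H = cong sum (mapSplits-cong w (λ R a v e → cong ⟦_⟧ (G≡H R a v e)))

  countLocal-+ : ∀ {G H₁ H₂} w → (∀ R a v → w ≡ R ++ a ∷ v → ⟦ G R a (next v) ⟧ ≡ ⟦ H₁ R a (next v) ⟧ + ⟦ H₂ R a (next v) ⟧)
    → countLocal G w ≡ countLocal H₁ w + countLocal H₂ w
  countLocal-+ []      _  = refl
  countLocal-+ {G} {H₁} {H₂} (a ∷ w) G≡ =
    trans (cong₂ _+_ (G≡ [] a w refl)
                     (countLocal-+ {λ R → G (a ∷ R)} {λ R → H₁ (a ∷ R)} {λ R → H₂ (a ∷ R)} w (λ R b v e → G≡ (a ∷ R) b v (cong (a ∷_) e))))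
                                                 (interchange ⟦ H₁ [] a (next w) ⟧ ⟦ H₂ [] a (next w) ⟧ _ _)

  countLocal-value : ∀ (t : ℕ → Bool) w → countLocal (λ _ a _ → t a) w ≡ count t w
  countLocal-value t []      = refl
  countLocal-value t (a ∷ w) with t a
  ... | true  = cong suc (countLocal-value t w)
  ... | false = countLocal-value t w

  <ᵇ-true : ∀ {m n} → m < n → (m <ᵇ n) ≡ true
  <ᵇ-true m<n = Equivalence.to T-≡ (<⇒<ᵇ m<n)

  <ᵇ-false : ∀ {m n} → n ≤ m → (m <ᵇ n) ≡ false
  <ᵇ-false {m} {n} n≤m with m <ᵇ n | <ᵇ-reflects-< m n
  ... | false | _       = refl
  ... | true  | ofʸ m<n = contradiction m<n (ℕ.≤⇒≯ n≤m)

  ≡ᵇ-refl : ∀ n → (n ≡ᵇ n) ≡ true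
  ≡ᵇ-refl n = Equivalence.to T-≡ (≡⇒≡ᵇ n n refl)

  ≡ᵇ-false : ∀ {m n} → m ≢ n → (m ≡ᵇ n) ≡ false
  ≡ᵇ-false {m} {n} m≢n with m ≡ᵇ n in eq
  ... | false = refl
  ... | true  = contradiction (≡ᵇ⇒≡ m n (Equivalence.from T-≡ eq)) m≢n

  count-++ : ∀ (p : ℕ → Bool) xs ys → count p (xs ++ ys) ≡ count p xs + count p ys
  count-++ p xs ys = begin
    count p (xs ++ ys)                                          ≡⟨ count≡sum p (xs ++ ys) ⟩
    sum (map (⟦_⟧ ∘ p) (xs ++ ys))                              ≡⟨ cong sum (map-++ (⟦_⟧ ∘ p) xs ys) ⟩
    sum (map (⟦_⟧ ∘ p) xs ++ map (⟦_⟧ ∘ p) ys)                  ≡⟨ sum-++ (map (⟦_⟧ ∘ p) xs) _ ⟩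
    sum (map (⟦_⟧ ∘ p) xs) + sum (map (⟦_⟧ ∘ p) ys)             ≡⟨ cong₂ _+_ (count≡sum p xs) (count≡sum p ys) ⟨
    count p xs + count p ys                                     ∎

  count-∷ʳ : ∀ (p : ℕ → Bool) xs x → count p (xs ∷ʳ x) ≡ count p xs + ⟦ p x ⟧
  count-∷ʳ p xs x = trans (count-++ p xs [ x ]) (cong (count p xs +_) (trans (count≡sum p [ x ]) (ℕ.+-identityʳ _)))

  count-cong : ∀ {p q : ℕ → Bool} n → (∀ {i} → 1 ≤ i → i ≤ n → p i ≡ q i) → count p (oneTo n) ≡ count q (oneTo n)
  count-cong {p} {q} n p≡q = begin
    count p (oneTo n)                          ≡⟨ count-oneTo p n ⟩
    sum (applyUpTo (λ j → ⟦ p (suc j) ⟧) n)    ≡⟨ cong sum (applyUpTo-cong n (λ j<n → cong ⟦_⟧ (p≡q (s≤s z≤n) j<n))) ⟩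
    sum (applyUpTo (λ j → ⟦ q (suc j) ⟧) n)    ≡⟨ count-oneTo q n ⟨
    count q (oneTo n)                          ∎

  count-false : ∀ xs → count (λ _ → false) xs ≡ 0
  count-false []       = refl
  count-false (x ∷ xs) = count-false xs

  count-∧-≤ : ∀ (p q : ℕ → Bool) xs → count (λ k → p k ∧ q k) xs ≤ count p xs
  count-∧-≤ p q []       = z≤n
  count-∧-≤ p q (x ∷ xs) with p x | q x
  ... | true  | true  = s≤s (count-∧-≤ p q xs)
  ... | true  | false = ℕ.m≤n⇒m≤1+n (count-∧-≤ p q xs)
  ... | false | _     = count-∧-≤ p q xs

  any≡count : ∀ b (q : ℕ → Bool) xs → count q xs ≤ 1 → ⟦ b ∧ any q xs ⟧ ≡ count (λ k → b ∧ q k) xs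
  any≡count false q xs       _ = sym (count-false xs)
  any≡count true  q []       _ = refl
  any≡count true  q (x ∷ xs) ≤1 with q x
  ... | false = any≡count true q xs ≤1
  ... | true with count q xs in eq
  ...   | zero = refl
  any≡count true q (x ∷ xs) (s≤s ()) | true | suc _

  at-beyond : ∀ w → at w (suc (length w)) ≡ 0
  at-beyond []      = refl
  at-beyond (a ∷ w) = at-beyond w

  at-∈ : ∀ w {i} → 1 ≤ i → i ≤ length w → at w i ∈ w
  at-∈ (a ∷ w) {suc zero}    _ _         = here refl
  at-∈ (a ∷ w) {suc (suc i)} _ (s≤s i≤n) = there (at-∈ w (s≤s z≤n) i≤n)

  at-injective : ∀ {w} → Unique w → ∀ {i j} → 1 ≤ i → i ≤ length w → 1 ≤ j → j ≤ length w → at w i ≡ at w j → i ≡ j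
  at-injective {a ∷ w} _ {suc zero} {suc zero} _ _ _ _ _ = refl
  at-injective {a ∷ w} (a∉ AllPairs.∷ _) {suc zero} {suc (suc j)} _ _ _ (s≤s j≤n) eq =
    contradiction eq (All.lookup a∉ (at-∈ w (s≤s z≤n) j≤n))
  at-injective {a ∷ w} (a∉ AllPairs.∷ _) {suc (suc i)} {suc zero} _ (s≤s i≤n) _ _ eq =
    contradiction (sym eq) (All.lookup a∉ (at-∈ w (s≤s z≤n) i≤n))
  at-injective {a ∷ w} (_ AllPairs.∷ uw) {suc (suc i)} {suc (suc j)} _ (s≤s i≤n) _ (s≤s j≤n) eq =
    cong suc (at-injective uw (s≤s z≤n) i≤n (s≤s z≤n) j≤n eq)

  take-suc : ∀ w {K} → K < length w → take (suc K) w ≡ take K w ∷ʳ at w (suc K)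
  take-suc (a ∷ w) {zero}  _         = refl
  take-suc (a ∷ w) {suc K} (s≤s K<n) = cong (a ∷_) (take-suc w K<n)

  map-at : ∀ w {K} → K ≤ length w → map (at w) (oneTo K) ≡ take K w
  map-at w {zero}  _   = refl
  map-at w {suc K} K<n = begin
    map (at w) (oneTo K ∷ʳ suc K)          ≡⟨ map-++ (at w) (oneTo K) [ suc K ] ⟩
    map (at w) (oneTo K) ∷ʳ at w (suc K)   ≡⟨ cong (_∷ʳ at w (suc K)) (map-at w (ℕ.<⇒≤ K<n)) ⟩
    take K w ∷ʳ at w (suc K)               ≡⟨ take-suc w K<n ⟨
    take (suc K) w                         ∎

  range-∷ʳ : ∀ {i n} → i ≤ n → range (suc i) (suc n) ≡ range (suc i) n ∷ʳ suc n
  range-∷ʳ {i} {n} i≤n rewrite <ᵇ-false i≤n = refl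

  range-empty : ∀ n → range (suc n) n ≡ []
  range-empty zero    = refl
  range-empty (suc n) rewrite <ᵇ-true (ℕ.n<1+n n) = refl

  oneTo-split : ∀ {i n} → i ≤ n → oneTo n ≡ oneTo i ++ range (suc i) n
  oneTo-split {i} {zero} z≤n = refl
  oneTo-split {i} {suc n} i≤n with i ℕ.≟ suc n
  ... | yes refl = sym (trans (cong (oneTo (suc n) ++_) (range-empty (suc n))) (++-identityʳ _))
  ... | no i≢n = let i≤n′ = ℕ.≤-pred (ℕ.≤∧≢⇒< i≤n i≢n) in begin
    oneTo n ∷ʳ suc n                       ≡⟨ cong (_∷ʳ suc n) (oneTo-split i≤n′) ⟩
    (oneTo i ++ range (suc i) n) ∷ʳ suc n  ≡⟨ ++-assoc (oneTo i) _ [ suc n ] ⟩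
    oneTo i ++ range (suc i) n ∷ʳ suc n    ≡⟨ cong (oneTo i ++_) (range-∷ʳ i≤n′) ⟨
    oneTo i ++ range (suc i) (suc n)       ∎

  descentAt successionAt bigAscentAt : LocalTest
  descentAt    _ a y = a >ᵇ y
  successionAt _ a y = y ≡ᵇ suc a
  bigAscentAt  _ a y = y ≥ᵇ suc (suc a)

  lrminIn : ℕ → List ℕ → Bool
  lrminIn c []      = false
  lrminIn c (b ∷ L) = (b ≡ᵇ c) ∨ ((c <ᵇ b) ∧ lrminIn c L)

  -- these positions are in bijection with the proper left-to-right minima, via a + 1 ↦ the position of a
  plrWitnessAt : LocalTest
  plrWitnessAt R a y = descentAt R a y ∧ lrminIn (suc a) R

  countLocal-adjacent : ∀ (t : ℕ → ℕ → Bool) a w → countLocal (λ _ → t) (a ∷ w)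
    ≡ count (λ i → t (at (a ∷ w) i) (at (a ∷ w) (suc i))) (oneTo (length w)) + ⟦ t (at (a ∷ w) (suc (length w))) 0 ⟧
  countLocal-adjacent t a w = begin
    countLocal (λ _ → t) (a ∷ w)
      ≡⟨ countLocal≡count (λ _ → t) (a ∷ w) ⟩
    count (λ i → t (p i) (p (suc i))) (oneTo (length w) ∷ʳ suc (length w))
      ≡⟨ count-∷ʳ (λ i → t (p i) (p (suc i))) (oneTo (length w)) (suc (length w)) ⟩
    count (λ i → t (p i) (p (suc i))) (oneTo (length w)) + ⟦ t (p (suc (length w))) (at w (suc (length w))) ⟧
      ≡⟨ cong (λ y → count (λ i → t (p i) (p (suc i))) (oneTo (length w)) + ⟦ t (p (suc (length w))) y ⟧) (at-beyond w) ⟩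
    count (λ i → t (p i) (p (suc i))) (oneTo (length w)) + ⟦ t (p (suc (length w))) 0 ⟧ ∎
    where
    p : ℕ → ℕ
    p = at (a ∷ w)

  suc′≡countLocal : ∀ w → suc' w ≡ countLocal successionAt w
  suc′≡countLocal []      = refl
  suc′≡countLocal (a ∷ w) = sym (trans (countLocal-adjacent (λ a y → y ≡ᵇ suc a) a w) (ℕ.+-identityʳ _))

  basc≡countLocal : ∀ w → basc w ≡ countLocal bigAscentAt w
  basc≡countLocal []      = refl
  basc≡countLocal (a ∷ w) = sym (trans (countLocal-adjacent (λ a y → y ≥ᵇ suc (suc a)) a w) (ℕ.+-identityʳ _))

  -- the last position of a word of positive letters is a descent, as π(n+1) = 0
  countLocal-descentAt : ∀ {n w} → IsPerm (suc n) w → countLocal descentAt w ≡ suc (des w)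
  countLocal-descentAt {n} {[]}    w-perm = case perm-length w-perm of λ ()
  countLocal-descentAt {n} {a ∷ w} w-perm = begin
    countLocal descentAt (a ∷ w)                       ≡⟨ countLocal-adjacent _>ᵇ_ a w ⟩
    des (a ∷ w) + ⟦ 0 <ᵇ at (a ∷ w) (suc (length w)) ⟧  ≡⟨ cong (λ b → des (a ∷ w) + ⟦ b ⟧) (<ᵇ-true last>0) ⟩
    des (a ∷ w) + 1                                    ≡⟨ ℕ.+-comm _ 1 ⟩
    suc (des (a ∷ w))                                  ∎
    where
    last>0 : 0 < at (a ∷ w) (suc (length w))
    last>0 = proj₁ (Equivalence.to (perm-∈⇔ w-perm) (at-∈ (a ∷ w) (s≤s z≤n) ℕ.≤-refl))

  lrminIn-absent : ∀ {c} L → c ∉ L → lrminIn c L ≡ false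
  lrminIn-absent     []      _   = refl
  lrminIn-absent {c} (b ∷ L) c∉L =
    trans (cong₂ (λ e l → e ∨ ((c <ᵇ b) ∧ l)) (≡ᵇ-false {b} {c} (λ { refl → c∉L (here refl) })) (lrminIn-absent L (c∉L ∘ there)))
          (∧-zeroʳ (c <ᵇ b))

  lrminIn-insert : ∀ {c m} A {B} → c < m → lrminIn c (A ++ m ∷ B) ≡ lrminIn c (A ++ B)
  lrminIn-insert {c} {m} []      {B} c<m =
    cong₂ (λ e b → e ∨ (b ∧ lrminIn c B)) (≡ᵇ-false {m} {c} (λ { refl → ℕ.<-irrefl refl c<m })) (<ᵇ-true c<m)
  lrminIn-insert {c}     (a ∷ A)     c<m = cong (λ l → (a ≡ᵇ c) ∨ ((c <ᵇ a) ∧ l)) (lrminIn-insert A c<m)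

  lrminIn-blocked : ∀ {c b} A {B} → c ∉ A → b < c → lrminIn c (A ++ b ∷ B) ≡ false
  lrminIn-blocked {c} {b} []      {B} _   b<c =
    cong₂ (λ e l → e ∨ (l ∧ lrminIn c B)) (≡ᵇ-false {b} {c} (λ { refl → ℕ.<-irrefl refl b<c })) (<ᵇ-false (ℕ.<⇒≤ b<c))
  lrminIn-blocked {c}     (a ∷ A)     c∉A b<c =
    trans (cong₂ (λ e l → e ∨ ((c <ᵇ a) ∧ l)) (≡ᵇ-false {a} {c} (λ { refl → c∉A (here refl) })) (lrminIn-blocked A (c∉A ∘ there) b<c))
          (∧-zeroʳ (c <ᵇ a))

  lrminIn-∷ʳ : ∀ c L b → lrminIn c (L ∷ʳ b) ≡ lrminIn c L ∨ ((b ≡ᵇ c) ∧ all (c <ᵇ_) L)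
  lrminIn-∷ʳ c []      b = trans (cong ((b ≡ᵇ c) ∨_) (∧-zeroʳ (c <ᵇ b))) (trans (∨-identityʳ _) (sym (∧-identityʳ _)))
  lrminIn-∷ʳ c (x ∷ L) b = trans (cong (λ l → (x ≡ᵇ c) ∨ ((c <ᵇ x) ∧ l)) (lrminIn-∷ʳ c L b))
                                 (distribute (x ≡ᵇ c) (c <ᵇ x) (lrminIn c L) (b ≡ᵇ c) (all (c <ᵇ_) L))
    where
    distribute : ∀ e l r f a → e ∨ (l ∧ (r ∨ (f ∧ a))) ≡ (e ∨ (l ∧ r)) ∨ (f ∧ (l ∧ a))
    distribute true  _     _     _     _ = refl
    distribute false true  true  _     _ = refl
    distribute false true  false f     _ = ∨-identityˡ _
    distribute false false _     f     _ = sym (∧-zeroʳ f)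

  any-∷ʳ : ∀ (p : ℕ → Bool) xs x → any p (xs ∷ʳ x) ≡ any p xs ∨ p x
  any-∷ʳ p []       x = ∨-identityʳ (p x)
  any-∷ʳ p (y ∷ xs) x = trans (cong (p y ∨_) (any-∷ʳ p xs x)) (sym (∨-assoc (p y) _ _))

  isLrmin-at : ∀ w c {K} → K < length w
    → (at w (suc K) ≡ᵇ c) ∧ isLrmin w (suc K) ≡ (at w (suc K) ≡ᵇ c) ∧ all (c <ᵇ_) (take K w)
  isLrmin-at w c {K} K<n with at w (suc K) ≡ᵇ c in eq
  ... | false = refl
  ... | true  = begin
    all (λ j → at w (suc K) <ᵇ at w j) (oneTo K)
      ≡⟨ cong (λ b → all (λ j → b <ᵇ at w j) (oneTo K)) (≡ᵇ⇒≡ _ c (Equivalence.from T-≡ eq)) ⟩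
    all (λ j → c <ᵇ at w j) (oneTo K)             ≡⟨ cong and (map-∘ (oneTo K)) ⟩
    all (c <ᵇ_) (map (at w) (oneTo K))            ≡⟨ cong (all (c <ᵇ_)) (map-at w (ℕ.<⇒≤ K<n)) ⟩
    all (c <ᵇ_) (take K w)                        ∎

  lrminIn-positions : ∀ w c {K} → K ≤ length w → any (λ i → (at w i ≡ᵇ c) ∧ isLrmin w i) (oneTo K) ≡ lrminIn c (take K w)
  lrminIn-positions w c {zero}  _   = refl
  lrminIn-positions w c {suc K} K<n = begin
    any g (oneTo K ∷ʳ suc K)
      ≡⟨ any-∷ʳ g (oneTo K) (suc K) ⟩
    any g (oneTo K) ∨ g (suc K)
      ≡⟨ cong₂ _∨_ (lrminIn-positions w c (ℕ.<⇒≤ K<n)) (isLrmin-at w c K<n) ⟩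
    lrminIn c (take K w) ∨ ((at w (suc K) ≡ᵇ c) ∧ all (c <ᵇ_) (take K w))
      ≡⟨ lrminIn-∷ʳ c (take K w) (at w (suc K)) ⟨
    lrminIn c (take K w ∷ʳ at w (suc K))
      ≡⟨ cong (lrminIn c) (take-suc w K<n) ⟨
    lrminIn c (take (suc K) w) ∎
    where
    g : ℕ → Bool
    g i = (at w i ≡ᵇ c) ∧ isLrmin w i

  sum-map-+ : ∀ (f g : ℕ → ℕ) xs → sum (map (λ x → f x + g x) xs) ≡ sum (map f xs) + sum (map g xs)
  sum-map-+ f g []       = refl
  sum-map-+ f g (x ∷ xs) = trans (cong (f x + g x +_) (sum-map-+ f g xs)) (interchange (f x) (g x) _ _)

  sum-map-oneTo-cong : ∀ {f g : ℕ → ℕ} n → (∀ {i} → 1 ≤ i → i ≤ n → f i ≡ g i) → sum (map f (oneTo n)) ≡ sum (map g (oneTo n))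
  sum-map-oneTo-cong {f} {g} n f≡g = begin
    sum (map f (oneTo n))             ≡⟨ cong (sum ∘ map f) (oneTo≡applyUpTo n) ⟩
    sum (map f (applyUpTo suc n))     ≡⟨ cong sum (map-applyUpTo suc f n) ⟩
    sum (applyUpTo (f ∘ suc) n)       ≡⟨ cong sum (applyUpTo-cong n (f≡g (s≤s z≤n))) ⟩
    sum (applyUpTo (g ∘ suc) n)       ≡⟨ cong sum (map-applyUpTo suc g n) ⟨
    sum (map g (applyUpTo suc n))     ≡⟨ cong (sum ∘ map g) (oneTo≡applyUpTo n) ⟨
    sum (map g (oneTo n))             ∎

  sum-map-∷ʳ : ∀ (f : ℕ → ℕ) xs x → sum (map f (xs ∷ʳ x)) ≡ sum (map f xs) + f x
  sum-map-∷ʳ f xs x = trans (cong sum (map-++ f xs [ x ])) (trans (sum-++ (map f xs) [ f x ]) (cong (sum (map f xs) +_) (ℕ.+-identityʳ (f x))))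

  -- both sides count the pairs i < k ≤ n with F i k
  count-pairs : ∀ (F : ℕ → ℕ → Bool) n →
    sum (map (λ i → count (F i) (range (suc i) n)) (oneTo n)) ≡ sum (map (λ k → count (λ i → F i k) (oneTo (k ∸ 1))) (oneTo n))
  count-pairs F zero    = refl
  count-pairs F (suc n) = begin
    sum (map (λ i → count (F i) (range (suc i) (suc n))) (oneTo n ∷ʳ suc n))
      ≡⟨ sum-map-∷ʳ _ (oneTo n) (suc n) ⟩
    sum (map (λ i → count (F i) (range (suc i) (suc n))) (oneTo n)) + count (F (suc n)) (range (suc (suc n)) (suc n))
      ≡⟨ cong₂ _+_ (sum-map-oneTo-cong n (λ {i} _ i≤n → trans (cong (count (F i)) (range-∷ʳ i≤n)) (count-∷ʳ (F i) (range (suc i) n) (suc n))))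
                   (cong (count (F (suc n))) (range-empty (suc n))) ⟩
    sum (map (λ i → count (F i) (range (suc i) n) + ⟦ F i (suc n) ⟧) (oneTo n)) + 0
      ≡⟨ trans (ℕ.+-identityʳ _) (sum-map-+ _ _ (oneTo n)) ⟩
    sum (map (λ i → count (F i) (range (suc i) n)) (oneTo n)) + sum (map (λ i → ⟦ F i (suc n) ⟧) (oneTo n))
      ≡⟨ cong₂ _+_ (sym (count-pairs F n)) (count≡sum (λ i → F i (suc n)) (oneTo n)) ⟨
    sum (map (λ k → count (λ i → F i k) (oneTo (k ∸ 1))) (oneTo n)) + count (λ i → F i (suc n)) (oneTo n)
      ≡⟨ sum-map-∷ʳ _ (oneTo n) (suc n) ⟨
    sum (map (λ k → count (λ i → F i k) (oneTo (k ∸ 1))) (oneTo n ∷ʳ suc n)) ∎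

  count-range≤count-oneTo : ∀ (p : ℕ → Bool) {i n} → i ≤ n → count p (range (suc i) n) ≤ count p (oneTo n)
  count-range≤count-oneTo p {i} {n} i≤n =
    subst (count p (range (suc i) n) ≤_) (trans (sym (count-++ p (oneTo i) _)) (cong (count p) (sym (oneTo-split i≤n))))
          (ℕ.m≤n+m _ (count p (oneTo i)))

  count-at-≤1 : ∀ {w} → Unique w → ∀ c {K} → K ≤ length w → count (λ k → at w k ≡ᵇ c) (oneTo K) ≤ 1
  count-at-≤1     uw c {zero}  _   = z≤n
  count-at-≤1 {w} uw c {suc K} K<n rewrite count-∷ʳ (λ k → at w k ≡ᵇ c) (oneTo K) (suc K) with at w (suc K) ≡ᵇ c in eq
  ... | false = subst (_≤ 1) (sym (ℕ.+-identityʳ _)) (count-at-≤1 uw c (ℕ.<⇒≤ K<n))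
  ... | true  = ℕ.≤-reflexive (cong (_+ 1) none)
    where
    none : count (λ k → at w k ≡ᵇ c) (oneTo K) ≡ 0
    none = trans (count-cong K (λ {i} 1≤i i≤K → ≡ᵇ-false (λ at≡c → ℕ.<-irrefl
                (at-injective uw 1≤i (ℕ.≤-trans i≤K (ℕ.<⇒≤ K<n)) (s≤s z≤n) K<n
                              (trans at≡c (sym (≡ᵇ⇒≡ _ c (Equivalence.from T-≡ eq))))) (s≤s i≤K))))
                 (count-false (oneTo K))

  witness-pair : ∀ l d a {c} → 1 ≤ c → (l ∧ not (a ≡ᵇ 1)) ∧ ((c ≡ᵇ a ∸ 1) ∧ d) ≡ d ∧ ((a ≡ᵇ suc c) ∧ l)
  witness-pair l d a {suc b} _ with a ≡ᵇ suc (suc b) in eq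
  ... | true with refl ← ≡ᵇ⇒≡ a _ (Equivalence.from T-≡ eq) rewrite ≡ᵇ-refl b = commute l d
    where
    commute : ∀ l d → (l ∧ true) ∧ d ≡ d ∧ l
    commute true  d = sym (∧-identityʳ d)
    commute false d = sym (∧-zeroʳ d)
  ... | false = trans (cong (λ e → (l ∧ not (a ≡ᵇ 1)) ∧ (e ∧ d)) (≡ᵇ-false {suc b} {a ∸ 1} b≢)) (trans (∧-zeroʳ _) (sym (∧-zeroʳ d)))
    where
    b≢ : suc b ≢ a ∸ 1
    b≢ e = subst T eq (≡⇒≡ᵇ a _ (∸1-inverse a e))
      where
      ∸1-inverse : ∀ a → suc b ≡ a ∸ 1 → a ≡ suc (suc b)
      ∸1-inverse (suc a) e = cong suc (sym e)

  module _ {n w} (w-perm : IsPerm n w) where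
    private
      N : ℕ
      N = length w

      p : ℕ → ℕ
      p = at w

      uw : Unique w
      uw = perm-unique w-perm

      positive : ∀ {i} → 1 ≤ i → i ≤ N → 1 ≤ p i
      positive 1≤i i≤N = proj₁ (Equivalence.to (perm-∈⇔ w-perm) (at-∈ w 1≤i i≤N))

      -- i is a proper left-to-right minimum witnessed by the descent top at k
      F : ℕ → ℕ → Bool
      F i k = (isLrmin w i ∧ not (p i ≡ᵇ 1)) ∧ ((p k ≡ᵇ p i ∸ 1) ∧ (p k >ᵇ p (suc k)))

      witness : ℕ → Bool
      witness k = plrWitnessAt (take (k ∸ 1) w) (p k) (p (suc k))

      plrmin-by-witnesses : ∀ {i} → 1 ≤ i → i ≤ N → ⟦ isPlrmin w i ⟧ ≡ count (F i) (range (suc i) N)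
      plrmin-by-witnesses {i} _ i≤N = trans (cong ⟦_⟧ (sym (∧-assoc (isLrmin w i) _ _)))
        (any≡count _ (λ k → (p k ≡ᵇ p i ∸ 1) ∧ (p k >ᵇ p (suc k))) (range (suc i) N)
          (ℕ.≤-trans (count-∧-≤ _ _ (range (suc i) N))
                     (ℕ.≤-trans (count-range≤count-oneTo _ i≤N) (count-at-≤1 uw (p i ∸ 1) ℕ.≤-refl))))

      witness-by-plrmins : ∀ {k} → 1 ≤ k → k ≤ N → count (λ i → F i k) (oneTo (k ∸ 1)) ≡ ⟦ witness k ⟧
      witness-by-plrmins {k} 1≤k k≤N = begin
        count (λ i → F i k) (oneTo (k ∸ 1))
          ≡⟨ count-cong (k ∸ 1) (λ {i} _ _ → witness-pair (isLrmin w i) D (p i) (positive 1≤k k≤N)) ⟩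
        count (λ i → D ∧ E i) (oneTo (k ∸ 1))
          ≡⟨ any≡count D E (oneTo (k ∸ 1)) (ℕ.≤-trans (count-∧-≤ _ _ (oneTo (k ∸ 1))) (count-at-≤1 uw (suc (p k)) k-1≤N)) ⟨
        ⟦ D ∧ any E (oneTo (k ∸ 1)) ⟧
          ≡⟨ cong (λ b → ⟦ D ∧ b ⟧) (lrminIn-positions w (suc (p k)) k-1≤N) ⟩
        ⟦ witness k ⟧ ∎
        where
        D : Bool
        D = p k >ᵇ p (suc k)
        E : ℕ → Bool
        E i = (p i ≡ᵇ suc (p k)) ∧ isLrmin w i
        k-1≤N : k ∸ 1 ≤ N
        k-1≤N = ℕ.≤-trans (ℕ.m∸n≤m k 1) k≤N

    plrmin≡countLocal : plrmin w ≡ countLocal plrWitnessAt w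
    plrmin≡countLocal = begin
      count (isPlrmin w) (oneTo N)
        ≡⟨ count≡sum (isPlrmin w) (oneTo N) ⟩
      sum (map (⟦_⟧ ∘ isPlrmin w) (oneTo N))
        ≡⟨ sum-map-oneTo-cong N plrmin-by-witnesses ⟩
      sum (map (λ i → count (F i) (range (suc i) N)) (oneTo N))
        ≡⟨ count-pairs F N ⟩
      sum (map (λ k → count (λ i → F i k) (oneTo (k ∸ 1))) (oneTo N))
        ≡⟨ sum-map-oneTo-cong N witness-by-plrmins ⟩
      sum (map (⟦_⟧ ∘ witness) (oneTo N))
        ≡⟨ count≡sum witness (oneTo N) ⟨
      count witness (oneTo N)
        ≡⟨ countLocal≡count plrWitnessAt w ⟨
      countLocal plrWitnessAt w ∎

  x+0≡y+1⇒x≡1+y : ∀ {x y} → x + 0 ≡ y + 1 → x ≡ suc y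
  x+0≡y+1⇒x≡1+y {x} {y} e = trans (sym (ℕ.+-identityʳ x)) (trans e (ℕ.+-comm y 1))

  x+0≡y⇒x≡y : ∀ {x y} → x + 0 ≡ y → x ≡ y
  x+0≡y⇒x≡y {x} e = trans (sym (ℕ.+-identityʳ x)) e

  x+1≡y+0⇒1+x≡y : ∀ {x y} → x + 1 ≡ y + 0 → suc x ≡ y
  x+1≡y+0⇒1+x≡y {x} {y} e = trans (ℕ.+-comm 1 x) (trans e (ℕ.+-identityʳ y))

  v+0+0≡v : ∀ {v} → (v ℚ.+ 0ℚ) ℚ.+ 0ℚ ≡ v
  v+0+0≡v = trans (ℚ.+-identityʳ _) (ℚ.+-identityʳ _)

  module ByKind {C : Set} (kinds : List C) (is : C → C → Bool)
    (decompose : ∀ (val : C → ℚ) k → ΣL kinds (λ c → ⟦ is c k ⟧ · val c) ≡ val k) where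

    occurrences : C → List C → ℕ
    occurrences c ks = sum (map (⟦_⟧ ∘ is c) ks)

    Σ-byKind : ∀ (ks : List C) val → ΣL ks val ≡ ΣL kinds (λ c → occurrences c ks · val c)
    Σ-byKind []       val = sym (zeros kinds)
      where
      zeros : ∀ cs → ΣL cs (λ _ → 0ℚ) ≡ 0ℚ
      zeros []       = refl
      zeros (c ∷ cs) = trans (ℚ.+-identityˡ _) (zeros cs)
    Σ-byKind (k ∷ ks) val = begin
      val k ℚ.+ ΣL ks val
        ≡⟨ cong₂ ℚ._+_ (decompose val k) (sym (Σ-byKind ks val)) ⟨
      ΣL kinds (λ c → ⟦ is c k ⟧ · val c) ℚ.+ ΣL kinds (λ c → occurrences c ks · val c)
        ≡⟨ Σ-+ kinds (λ c → ⟦ is c k ⟧ · val c) (λ c → occurrences c ks · val c) ⟨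
      ΣL kinds (λ c → ⟦ is c k ⟧ · val c ℚ.+ occurrences c ks · val c)
        ≡⟨ Σ-cong kinds (λ {c} _ → ×-homo-+ (val c) ⟦ is c k ⟧ (occurrences c ks)) ⟨
      ΣL kinds (λ c → occurrences c (k ∷ ks) · val c) ∎

module LetterSlots where

  open Permutations
  open WeightOperators using (Stats; stats≡; letterStep; ℚ-ring)
  open LocalStatistics
  open import Defs hiding (_^_)
  open import Function using (_∘_; Equivalence)
  open import Algebra.Bundles using (CommutativeRing)
  open import Data.Bool using (Bool; true; false; _∧_; _∨_; not)
  open import Data.Bool.Properties using (T-≡; ∧-zeroʳ)
  open import Data.Nat as ℕ using (ℕ; suc; _+_; _∸_; _≤_; _<_; z≤n; s≤s; _≡ᵇ_; _<ᵇ_)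
  import Data.Nat.Properties as ℕ
  open import Data.Nat.Properties using (≡ᵇ⇒≡)
  open import Data.Nat.ListAction using (sum)
  open import Data.Product using (_,_; proj₁; proj₂)
  open import Data.List as List using (List; []; _∷_; _++_; _∷ʳ_)
  open import Data.List.Properties using (++-assoc)
  open import Data.List.Membership.Propositional using (_∈_; _∉_)
  open import Data.List.Membership.Propositional.Properties using (∈-++⁺ˡ; ∈-++⁺ʳ)
  open import Data.List.Relation.Unary.Any using (here; there)
  import Data.List.Relation.Unary.All as All
  import Data.List.Relation.Unary.AllPairs as AllPairs
  open import Data.List.Relation.Unary.Unique.Propositional using (Unique)
  import Data.List.Relation.Unary.Unique.Propositional.Properties as Unique
  open import Data.Rational as ℚ using (ℚ; 0ℚ)
  import Data.Rational.Properties as ℚ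
  open import Algebra.Properties.Semiring.Mult (CommutativeRing.semiring ℚ.+-*-commutativeRing)
    using () renaming (_×_ to _·_)
  open import Tactic.RingSolver using (solve-∀)
  open import Relation.Nullary using (yes; no; contradiction)
  open import Relation.Binary.Definitions using (tri<; tri≈; tri>)
  open import Relation.Binary.PropositionalEquality hiding ([_])
  open ≡-Reasoning

  data LetterSlot : Set where
    afterMax inSuccession inBigAscent inWitness inOtherDescent : LetterSlot

  letterSlots : List LetterSlot
  letterSlots = afterMax ∷ inSuccession ∷ inBigAscent ∷ inWitness ∷ inOtherDescent ∷ []

  private
    letterIndex : LetterSlot → ℕ
    letterIndex afterMax       = 0
    letterIndex inSuccession   = 1
    letterIndex inBigAscent    = 2
    letterIndex inWitness      = 3
    letterIndex inOtherDescent = 4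

  _≈ˡ_ : LetterSlot → LetterSlot → Bool
  c ≈ˡ k = letterIndex c ≡ᵇ letterIndex k

  letter-decompose : ∀ (val : LetterSlot → ℚ) k → ΣL letterSlots (λ c → ⟦ c ≈ˡ k ⟧ · val c) ≡ val k
  letter-decompose val afterMax       = v+0+0≡v
  letter-decompose val inSuccession   = trans (ℚ.+-identityˡ _) v+0+0≡v
  letter-decompose val inBigAscent    = trans (ℚ.+-identityˡ _) (trans (ℚ.+-identityˡ _) v+0+0≡v)
  letter-decompose val inWitness      = trans (ℚ.+-identityˡ _) (trans (ℚ.+-identityˡ _) (trans (ℚ.+-identityˡ _) v+0+0≡v))
  letter-decompose val inOtherDescent =
    trans (ℚ.+-identityˡ _) (trans (ℚ.+-identityˡ _) (trans (ℚ.+-identityˡ _) (trans (ℚ.+-identityˡ _) v+0+0≡v)))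

  slotKind : (isMax succ big witness : Bool) → LetterSlot
  slotKind true  _     _     _     = afterMax
  slotKind false true  _     _     = inSuccession
  slotKind false false true  _     = inBigAscent
  slotKind false false false true  = inWitness
  slotKind false false false false = inOtherDescent

  classifyLetterSlot : ℕ → List ℕ → ℕ → ℕ → LetterSlot
  classifyLetterSlot M R x y = slotKind (M ≡ᵇ x) (successionAt R x y) (bigAscentAt R x y) (plrWitnessAt R x y)

  isDescentSlot : LetterSlot → Bool
  isDescentSlot afterMax       = true
  isDescentSlot inSuccession   = false
  isDescentSlot inBigAscent    = false
  isDescentSlot inWitness      = true
  isDescentSlot inOtherDescent = true

  data Adjacency (x y : ℕ) : Set where
    descent    : y < x → Adjacency x y
    succession : y ≡ suc x → Adjacency x y
    bigAscent  : suc (suc x) ≤ y → Adjacency x y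

  adjacency : ∀ {x y} → y ≢ x → Adjacency x y
  adjacency {x} {y} y≢x with ℕ.<-cmp y x
  ... | tri< y<x _ _ = descent y<x
  ... | tri≈ _ y≡x _ = contradiction y≡x y≢x
  ... | tri> _ _ x<y with y ℕ.≟ suc x
  ...   | yes y≡ = succession y≡
  ...   | no  y≢ = bigAscent (ℕ.≤∧≢⇒< x<y (y≢ ∘ sym))

  no-succession : ∀ {R x y} → y < x → successionAt R x y ≡ false
  no-succession {x = x} {y} y<x = ≡ᵇ-false {y} {suc x} (λ { refl → ℕ.<-asym y<x (ℕ.n<1+n x) })

  no-bigAscent : ∀ {R x y} → y < x → bigAscentAt R x y ≡ false
  no-bigAscent y<x = cong not (<ᵇ-true (ℕ.m<n⇒m<1+n (ℕ.m<n⇒m<1+n y<x)))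

  record KindTests (R : List ℕ) (x y : ℕ) (k : LetterSlot) : Set where
    field
      descent≡    : descentAt R x y ≡ isDescentSlot k
      succession≡ : successionAt R x y ≡ inSuccession ≈ˡ k
      bigAscent≡  : bigAscentAt R x y ≡ inBigAscent ≈ˡ k
      witness≡    : plrWitnessAt R x y ≡ inWitness ≈ˡ k

  kindTests : ∀ {M} R {x y} → x ≤ M → y ≤ M → y ≢ x → lrminIn (suc M) R ≡ false → KindTests R x y (classifyLetterSlot M R x y)
  kindTests {M} R {x} {y} x≤M y≤M y≢x R-noMax with adjacency y≢x | M ≡ᵇ x in isMax
  ... | descent y<x | true with refl ← ≡ᵇ⇒≡ M x (Equivalence.from T-≡ isMax) = record
    { descent≡ = <ᵇ-true y<x ; succession≡ = no-succession {R = R} y<x ; bigAscent≡ = no-bigAscent {R = R} y<x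
    ; witness≡ = cong₂ _∧_ (<ᵇ-true y<x) R-noMax }
  ... | succession refl | true = contradiction (sym (≡ᵇ⇒≡ M x (Equivalence.from T-≡ isMax))) (ℕ.<⇒≢ y≤M)
  ... | succession refl | false rewrite ≡ᵇ-refl x = record
    { descent≡ = <ᵇ-false (ℕ.n≤1+n x) ; succession≡ = ≡ᵇ-refl x ; bigAscent≡ = cong not (<ᵇ-true (ℕ.n<1+n x))
    ; witness≡ = cong (_∧ lrminIn (suc x) R) (<ᵇ-false (ℕ.n≤1+n x)) }
  ... | bigAscent x+2≤y | true =
    contradiction (sym (≡ᵇ⇒≡ M x (Equivalence.from T-≡ isMax))) (ℕ.<⇒≢ (ℕ.≤-trans (ℕ.n≤1+n _) (ℕ.≤-trans x+2≤y y≤M)))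
  ... | bigAscent x+2≤y | false rewrite ≡ᵇ-false {y} {suc x} (λ { refl → ℕ.<-irrefl refl x+2≤y }) | <ᵇ-false x+2≤y = record
    { descent≡ = x≯y ; succession≡ = ≡ᵇ-false {y} {suc x} (λ { refl → ℕ.<-irrefl refl x+2≤y }) ; bigAscent≡ = cong not (<ᵇ-false x+2≤y)
    ; witness≡ = cong (_∧ lrminIn (suc x) R) x≯y }
    where
    x≯y : (y <ᵇ x) ≡ false
    x≯y = <ᵇ-false (ℕ.≤-trans (ℕ.n≤1+n x) (ℕ.≤-trans (ℕ.n≤1+n (suc x)) x+2≤y))
  ... | descent y<x | false
    rewrite no-succession {R = R} y<x | no-bigAscent {R = R} y<x | <ᵇ-true y<x with lrminIn (suc x) R in lrmin
  ...   | true  = record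
    { descent≡ = <ᵇ-true y<x ; succession≡ = no-succession {R = R} y<x ; bigAscent≡ = no-bigAscent {R = R} y<x
    ; witness≡ = cong₂ _∧_ (<ᵇ-true y<x) lrmin }
  ...   | false = record
    { descent≡ = <ᵇ-true y<x ; succession≡ = no-succession {R = R} y<x ; bigAscent≡ = no-bigAscent {R = R} y<x
    ; witness≡ = cong₂ _∧_ (<ᵇ-true y<x) lrmin }

  isAfterMax : ∀ M R x y → afterMax ≈ˡ classifyLetterSlot M R x y ≡ (M ≡ᵇ x)
  isAfterMax M R x y with M ≡ᵇ x | successionAt R x y | bigAscentAt R x y | plrWitnessAt R x y
  ... | true  | _     | _     | _     = refl
  ... | false | true  | _     | _     = refl
  ... | false | false | true  | _     = refl
  ... | false | false | false | true  = refl
  ... | false | false | false | false = refl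

  letterStats : List ℕ → Stats
  letterStats π = basc π , des π ∸ plrmin π , suc' π , plrmin π

  letterEffect : LetterSlot → Stats → Stats
  letterEffect afterMax       (a , b , c , d) = a , b , suc c , d
  letterEffect inSuccession   (a , b , c , d) = suc a , suc b , c ∸ 1 , d
  letterEffect inBigAscent    (a , b , c , d) = a , suc b , c , d
  letterEffect inWitness      (a , b , c , d) = suc a , suc b , c , d ∸ 1
  letterEffect inOtherDescent (a , b , c , d) = suc a , b , c , d

  letterMultiplicity : LetterSlot → Stats → ℕ
  letterMultiplicity afterMax       _               = 1
  letterMultiplicity inSuccession   (a , b , c , d) = c
  letterMultiplicity inBigAscent    (a , b , c , d) = a
  letterMultiplicity inWitness      (a , b , c , d) = d
  letterMultiplicity inOtherDescent (a , b , c , d) = b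

  letterStep-byKind : ∀ g a b c d → letterStep g (a , b , c , d)
    ≡ g (a , b , c , suc d) ℚ.+ ΣL letterSlots (λ k → letterMultiplicity k (a , b , c , d) · g (letterEffect k (a , b , c , d)))
  letterStep-byKind g a b c d = cong (g (a , b , c , suc d) ℚ.+_)
    (pad (g (a , b , suc c , d)) (c · g (suc a , suc b , c ∸ 1 , d)) (a · g (a , suc b , c , d))
         (d · g (suc a , suc b , c , d ∸ 1)) (b · g (suc a , b , c , d)))
    where
    pad : ∀ v w₁ w₂ w₃ w₄ → v ℚ.+ (w₁ ℚ.+ (w₂ ℚ.+ (w₃ ℚ.+ w₄))) ≡ (v ℚ.+ 0ℚ) ℚ.+ (w₁ ℚ.+ (w₂ ℚ.+ (w₃ ℚ.+ (w₄ ℚ.+ 0ℚ))))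
    pad = solve-∀ ℚ-ring

  -- solves the local balance equations of an insertion for the new statistics
  stats-of-kind : ∀ k {b d s l b′ d′ s′ l′} → l ≤ d
    → b′ + ⟦ inBigAscent ≈ˡ k ⟧ ≡ b + ⟦ not (afterMax ≈ˡ k) ⟧
    → d′ + ⟦ isDescentSlot k ⟧ ≡ d + 1
    → s′ + ⟦ inSuccession ≈ˡ k ⟧ ≡ s + ⟦ afterMax ≈ˡ k ⟧
    → l′ + ⟦ inWitness ≈ˡ k ⟧ ≡ l
    → (b′ , d′ ∸ l′ , s′ , l′) ≡ letterEffect k (b , d ∸ l , s , l)
  stats-of-kind afterMax       l≤d Eb Ed Es El =
    stats≡ (ℕ.+-cancelʳ-≡ 0 _ _ Eb) (cong₂ _∸_ (ℕ.+-cancelʳ-≡ 1 _ _ Ed) (x+0≡y⇒x≡y El)) (x+0≡y+1⇒x≡1+y Es) (x+0≡y⇒x≡y El)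
  stats-of-kind inSuccession   l≤d Eb Ed Es El =
    stats≡ (x+0≡y+1⇒x≡1+y Eb) (trans (cong₂ _∸_ (x+0≡y+1⇒x≡1+y Ed) (x+0≡y⇒x≡y El)) (ℕ.+-∸-assoc 1 l≤d))
           (cong (_∸ 1) (x+1≡y+0⇒1+x≡y Es)) (x+0≡y⇒x≡y El)
  stats-of-kind inBigAscent    l≤d Eb Ed Es El =
    stats≡ (ℕ.+-cancelʳ-≡ 1 _ _ Eb) (trans (cong₂ _∸_ (x+0≡y+1⇒x≡1+y Ed) (x+0≡y⇒x≡y El)) (ℕ.+-∸-assoc 1 l≤d))
           (ℕ.+-cancelʳ-≡ 0 _ _ Es) (x+0≡y⇒x≡y El)
  stats-of-kind inWitness      {l′ = l′} l≤d Eb Ed Es El with trans (ℕ.+-comm 1 l′) El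
  ... | refl = stats≡ (x+0≡y+1⇒x≡1+y Eb) (trans (cong (_∸ l′) (ℕ.+-cancelʳ-≡ 1 _ _ Ed)) (ℕ.+-∸-assoc 1 l≤d))
                      (ℕ.+-cancelʳ-≡ 0 _ _ Es) refl
  stats-of-kind inOtherDescent l≤d Eb Ed Es El =
    stats≡ (x+0≡y+1⇒x≡1+y Eb) (cong₂ _∸_ (ℕ.+-cancelʳ-≡ 1 _ _ Ed) (x+0≡y⇒x≡y El)) (ℕ.+-cancelʳ-≡ 0 _ _ Es) (x+0≡y⇒x≡y El)

  ∉-suffix : ∀ {x : ℕ} R {v} → Unique (R ++ x ∷ v) → x ∉ v
  ∉-suffix []      u                = Unique.Unique[x∷xs]⇒x∉xs u
  ∉-suffix (a ∷ R) (_ AllPairs.∷ u) = ∉-suffix R u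

  count-≡ᵇ-∉ : ∀ {a} w → a ∉ w → count (a ≡ᵇ_) w ≡ 0
  count-≡ᵇ-∉     []      _   = refl
  count-≡ᵇ-∉ {a} (b ∷ w) a∉w rewrite ≡ᵇ-false {a} {b} (λ { refl → a∉w (here refl) }) = count-≡ᵇ-∉ w (a∉w ∘ there)

  count-≡ᵇ-unique : ∀ {a w} → Unique w → a ∈ w → count (a ≡ᵇ_) w ≡ 1
  count-≡ᵇ-unique {a} {a ∷ w} (a∉ AllPairs.∷ _) (here refl) rewrite ≡ᵇ-refl a =
    cong suc (count-≡ᵇ-∉ w (λ a∈ → All.lookup a∉ a∈ refl))
  count-≡ᵇ-unique {a} {b ∷ w} (b∉ AllPairs.∷ uw) (there a∈) rewrite ≡ᵇ-false {a} {b} (λ { refl → All.lookup b∉ a∈ refl }) =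
    count-≡ᵇ-unique uw a∈

  next-≢ : ∀ {x} v → 1 ≤ x → x ∉ v → next v ≢ x
  next-≢ []      1≤x _   0≡x = ℕ.<⇒≢ 1≤x 0≡x
  next-≢ (b ∷ v) _   x∉v b≡x = x∉v (here (sym b≡x))

  M<ᵇ1+x : ∀ {M x} → x ≤ M → (M <ᵇ suc x) ≡ (M ≡ᵇ x)
  M<ᵇ1+x {M} {x} x≤M with M ℕ.≟ x
  ... | yes refl = trans (<ᵇ-true (ℕ.n<1+n M)) (sym (≡ᵇ-refl M))
  ... | no M≢x   = trans (<ᵇ-false (ℕ.≤∧≢⇒< x≤M (M≢x ∘ sym))) (sym (≡ᵇ-false M≢x))

  module LetterInsertion {N p} (p-perm : IsPerm (suc N) p) where
    private
      M m : ℕ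
      M = suc N
      m = suc M

      ≤M : ∀ {a} → a ∈ p → a ≤ M
      ≤M a∈ = proj₂ (Equivalence.to (perm-∈⇔ p-perm) a∈)

      M∈p : M ∈ p
      M∈p = Equivalence.from (perm-∈⇔ p-perm) (s≤s z≤n , ℕ.≤-refl)

      prefix-∈ : ∀ {u w a} → p ≡ u ++ w → a ∈ u → a ∈ p
      prefix-∈ p≡ a∈ = subst (_ ∈_) (sym p≡) (∈-++⁺ˡ a∈)

      suffix-∈ : ∀ u {w a} → p ≡ u ++ w → a ∈ w → a ∈ p
      suffix-∈ u p≡ a∈ = subst (_ ∈_) (sym p≡) (∈-++⁺ʳ u a∈)

      next≤M : ∀ u {w} → p ≡ u ++ w → next w ≤ M
      next≤M u {[]}    _  = z≤n
      next≤M u {b ∷ w} p≡ = ≤M (suffix-∈ u p≡ (here refl))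

      M-once : countLocal (λ _ a _ → M ≡ᵇ a) p ≡ 1
      M-once = trans (countLocal-value (M ≡ᵇ_) p) (count-≡ᵇ-unique (perm-unique p-perm) M∈p)

      large∉ : ∀ {u w a} → p ≡ u ++ w → M < a → a ∉ u
      large∉ p≡ M<a a∈ = ℕ.<⇒≱ M<a (≤M (prefix-∈ p≡ a∈))

    module Slot {R x v} (split : p ≡ R ++ x ∷ v) where
      q : List ℕ
      q = R ++ x ∷ m ∷ v
      y : ℕ
      y = next v

      x∈p : x ∈ p
      x∈p = suffix-∈ R split (here refl)

      x≤M : x ≤ M
      x≤M = ≤M x∈p

      y≢x : y ≢ x
      y≢x = next-≢ v (proj₁ (Equivalence.to (perm-∈⇔ p-perm) x∈p)) (∉-suffix R (subst Unique split (perm-unique p-perm)))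

      R-noMax : lrminIn m R ≡ false
      R-noMax = lrminIn-absent R (large∉ split (ℕ.n<1+n M))

      split′ : p ≡ (R ∷ʳ x) ++ v
      split′ = trans split (++-∷ʳ R x v)

      y≤M : y ≤ M
      y≤M = next≤M (R ∷ʳ x) split′

      y<m : y < m
      y<m = s≤s y≤M

      m≮x : (m <ᵇ x) ≡ false
      m≮x = <ᵇ-false (ℕ.≤-trans x≤M (ℕ.n≤1+n M))

      tests : KindTests R x y (classifyLetterSlot M R x y)
      tests = kindTests R x≤M y≤M y≢x R-noMax

      q-perm : IsPerm (suc M) q
      q-perm = subst (IsPerm (suc M)) (sym (++-∷ʳ R x (m ∷ v))) (insert-max-perm (R ∷ʳ x) (subst (IsPerm M) split′ p-perm))

      bigAscent-balance : basc q + ⟦ bigAscentAt R x y ⟧ ≡ basc p + ⟦ not (M ≡ᵇ x) ⟧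
      bigAscent-balance = begin
        basc q + ⟦ bigAscentAt R x y ⟧
          ≡⟨ cong (_+ ⟦ bigAscentAt R x y ⟧) (basc≡countLocal q) ⟩
        countLocal bigAscentAt q + ⟦ bigAscentAt R x y ⟧
          ≡⟨ countLocal-insert bigAscentAt R x m v refl ⟩
        countLocal bigAscentAt (R ++ x ∷ v) + (⟦ not (M <ᵇ suc x) ⟧ + ⟦ not (y <ᵇ suc (suc m)) ⟧)
          ≡⟨ cong₂ _+_ (trans (cong (countLocal bigAscentAt) (sym split)) (sym (basc≡countLocal p)))
                       (cong₂ (λ a b → ⟦ not a ⟧ + ⟦ not b ⟧) (M<ᵇ1+x x≤M) (<ᵇ-true (ℕ.m<n⇒m<1+n (ℕ.m<n⇒m<1+n y<m)))) ⟩
        basc p + (⟦ not (M ≡ᵇ x) ⟧ + 0)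
          ≡⟨ cong (basc p +_) (ℕ.+-identityʳ _) ⟩
        basc p + ⟦ not (M ≡ᵇ x) ⟧ ∎

      succession-balance : suc' q + ⟦ successionAt R x y ⟧ ≡ suc' p + ⟦ M ≡ᵇ x ⟧
      succession-balance = begin
        suc' q + ⟦ successionAt R x y ⟧
          ≡⟨ cong (_+ ⟦ successionAt R x y ⟧) (suc′≡countLocal q) ⟩
        countLocal successionAt q + ⟦ successionAt R x y ⟧
          ≡⟨ countLocal-insert successionAt R x m v refl ⟩
        countLocal successionAt (R ++ x ∷ v) + (⟦ M ≡ᵇ x ⟧ + ⟦ y ≡ᵇ suc m ⟧)
          ≡⟨ cong₂ _+_ (trans (cong (countLocal successionAt) (sym split)) (sym (suc′≡countLocal p)))
                       (cong (λ b → ⟦ M ≡ᵇ x ⟧ + ⟦ b ⟧) (≡ᵇ-false {y} {suc m} (ℕ.<⇒≢ (ℕ.m<n⇒m<1+n y<m)))) ⟩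
        suc' p + (⟦ M ≡ᵇ x ⟧ + 0)
          ≡⟨ cong (suc' p +_) (ℕ.+-identityʳ _) ⟩
        suc' p + ⟦ M ≡ᵇ x ⟧ ∎

      descent-balance : des q + ⟦ descentAt R x y ⟧ ≡ des p + 1
      descent-balance = ℕ.suc-injective (begin
        suc (des q) + ⟦ descentAt R x y ⟧
          ≡⟨ cong (_+ ⟦ descentAt R x y ⟧) (countLocal-descentAt q-perm) ⟨
        countLocal descentAt q + ⟦ descentAt R x y ⟧
          ≡⟨ countLocal-insert descentAt R x m v refl ⟩
        countLocal descentAt (R ++ x ∷ v) + (⟦ m <ᵇ x ⟧ + ⟦ y <ᵇ m ⟧)
          ≡⟨ cong₂ _+_ (trans (cong (countLocal descentAt) (sym split)) (countLocal-descentAt p-perm))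
                       (cong₂ (λ a b → ⟦ a ⟧ + ⟦ b ⟧) m≮x (<ᵇ-true y<m)) ⟩
        suc (des p) + 1 ∎)

      split-after : ∀ {R′ a v′} → v ≡ R′ ++ a ∷ v′ → p ≡ (R ++ x ∷ R′) ++ a ∷ v′
      split-after {R′} {a} {v′} v≡ = trans split (trans (cong (λ u → R ++ x ∷ u) v≡) (sym (++-assoc R (x ∷ R′) (a ∷ v′))))

      -- for a later letter a, m can only hide a + 1 = m itself, which x < m hides anyway
      lrminIn-after-insertion : ∀ R′ a {v′} → v ≡ R′ ++ a ∷ v′ → lrminIn (suc a) (R ++ x ∷ m ∷ R′) ≡ lrminIn (suc a) (R ++ x ∷ R′)
      lrminIn-after-insertion R′ a v≡ with a ℕ.≟ M
      ... | no a≢M = begin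
        lrminIn (suc a) (R ++ x ∷ m ∷ R′)      ≡⟨ cong (lrminIn (suc a)) (++-∷ʳ R x (m ∷ R′)) ⟩
        lrminIn (suc a) ((R ∷ʳ x) ++ m ∷ R′)   ≡⟨ lrminIn-insert (R ∷ʳ x) (s≤s (ℕ.≤∧≢⇒< (≤M (suffix-∈ (R ++ x ∷ R′) (split-after v≡) (here refl))) a≢M)) ⟩
        lrminIn (suc a) ((R ∷ʳ x) ++ R′)       ≡⟨ cong (lrminIn (suc a)) (++-∷ʳ R x R′) ⟨
        lrminIn (suc a) (R ++ x ∷ R′)          ∎
      ... | yes refl =
        trans (lrminIn-blocked R (large∉ split (ℕ.n<1+n M)) (s≤s x≤M)) (sym (lrminIn-absent (R ++ x ∷ R′) (large∉ (split-after v≡) (ℕ.n<1+n M))))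

      witness-balance : plrmin q + ⟦ plrWitnessAt R x y ⟧ ≡ plrmin p
      witness-balance = begin
        plrmin q + ⟦ plrWitnessAt R x y ⟧
          ≡⟨ cong (_+ ⟦ plrWitnessAt R x y ⟧) (plrmin≡countLocal q-perm) ⟩
        countLocal plrWitnessAt q + ⟦ plrWitnessAt R x y ⟧
          ≡⟨ countLocal-insert plrWitnessAt R x m v tail ⟩
        countLocal plrWitnessAt (R ++ x ∷ v)
          + (⟦ (m <ᵇ x) ∧ lrminIn (suc x) R ⟧ + ⟦ (y <ᵇ m) ∧ lrminIn (suc m) (R ∷ʳ x) ⟧)
          ≡⟨ cong₂ _+_ (trans (cong (countLocal plrWitnessAt) (sym split)) (sym (plrmin≡countLocal p-perm)))
                       (cong₂ (λ a b → ⟦ a ∧ lrminIn (suc x) R ⟧ + ⟦ (y <ᵇ m) ∧ b ⟧) m≮x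
                              (lrminIn-absent (R ∷ʳ x) (large∉ split′ (ℕ.m<n⇒m<1+n (ℕ.n<1+n M))))) ⟩
        plrmin p + (0 + ⟦ (y <ᵇ m) ∧ false ⟧)
          ≡⟨ cong (λ b → plrmin p + ⟦ b ⟧) (∧-zeroʳ (y <ᵇ m)) ⟩
        plrmin p + 0
          ≡⟨ ℕ.+-identityʳ _ ⟩
        plrmin p ∎
        where
        tail : countLocal (λ R′ → plrWitnessAt (R ++ x ∷ m ∷ R′)) v ≡ countLocal (λ R′ → plrWitnessAt (R ++ x ∷ R′)) v
        tail = countLocal-cong {λ R′ → plrWitnessAt (R ++ x ∷ m ∷ R′)} {λ R′ → plrWitnessAt (R ++ x ∷ R′)} v
          (λ R′ a v′ v≡ → cong ((a >ᵇ next v′) ∧_) (lrminIn-after-insertion R′ a v≡))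

    open ByKind letterSlots _≈ˡ_ letter-decompose

    kindsOfSlots : List LetterSlot
    kindsOfSlots = mapSplits (λ R x v → classifyLetterSlot M R x (next v)) p

    private
      kind : List ℕ → ℕ → ℕ → LetterSlot
      kind = classifyLetterSlot M

      slots : LetterSlot → ℕ
      slots c = countLocal (λ R x y → c ≈ˡ kind R x y) p

      occurrences≡slots : ∀ c → occurrences c kindsOfSlots ≡ slots c
      occurrences≡slots c = cong sum (map-mapSplits (⟦_⟧ ∘ (c ≈ˡ_)) _ p)

      slots-afterMax : slots afterMax ≡ 1
      slots-afterMax =
        trans (countLocal-cong {λ R a y → afterMax ≈ˡ kind R a y} {λ _ a _ → M ≡ᵇ a} p (λ R a v _ → isAfterMax M R a (next v))) M-once

      slots-inSuccession : slots inSuccession ≡ suc' p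
      slots-inSuccession = trans (countLocal-cong {λ R a y → inSuccession ≈ˡ kind R a y} {successionAt} p
                                   (λ R a v split → sym (KindTests.succession≡ (Slot.tests split))))
                                 (sym (suc′≡countLocal p))

      slots-inBigAscent : slots inBigAscent ≡ basc p
      slots-inBigAscent = trans (countLocal-cong {λ R a y → inBigAscent ≈ˡ kind R a y} {bigAscentAt} p
                                  (λ R a v split → sym (KindTests.bigAscent≡ (Slot.tests split))))
                                (sym (basc≡countLocal p))

      slots-inWitness : slots inWitness ≡ plrmin p
      slots-inWitness = trans (countLocal-cong {λ R a y → inWitness ≈ˡ kind R a y} {plrWitnessAt} p
                                (λ R a v split → sym (KindTests.witness≡ (Slot.tests split))))
                              (sym (plrmin≡countLocal p-perm))

      descent-kinds : ∀ k → ⟦ isDescentSlot k ⟧ ≡ ⟦ afterMax ≈ˡ k ⟧ + (⟦ inWitness ≈ˡ k ⟧ + ⟦ inOtherDescent ≈ˡ k ⟧)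
      descent-kinds afterMax       = refl
      descent-kinds inSuccession   = refl
      descent-kinds inBigAscent    = refl
      descent-kinds inWitness      = refl
      descent-kinds inOtherDescent = refl

      witnessOrOther : LetterSlot → Bool
      witnessOrOther k = inWitness ≈ˡ k ∨ inOtherDescent ≈ˡ k

      witnessOrOther-split : ∀ k → ⟦ witnessOrOther k ⟧ ≡ ⟦ inWitness ≈ˡ k ⟧ + ⟦ inOtherDescent ≈ˡ k ⟧
      witnessOrOther-split afterMax       = refl
      witnessOrOther-split inSuccession   = refl
      witnessOrOther-split inBigAscent    = refl
      witnessOrOther-split inWitness      = refl
      witnessOrOther-split inOtherDescent = refl

      -- every descent slot (including the last position, followed by 0) is after M, a witness or another descent
      des≡ : des p ≡ plrmin p + slots inOtherDescent
      des≡ = ℕ.suc-injective (begin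
        suc (des p)
          ≡⟨ countLocal-descentAt p-perm ⟨
        countLocal descentAt p
          ≡⟨ countLocal-+ {descentAt} {λ R a y → afterMax ≈ˡ kind R a y} {λ R a y → witnessOrOther (kind R a y)} p
               (λ R a v split → let k = kind R a (next v) in
                 trans (cong ⟦_⟧ (KindTests.descent≡ (Slot.tests split)))
                       (trans (descent-kinds k) (cong (⟦ afterMax ≈ˡ k ⟧ +_) (sym (witnessOrOther-split k))))) ⟩
        slots afterMax + countLocal (λ R a y → witnessOrOther (kind R a y)) p
          ≡⟨ cong₂ _+_ slots-afterMax (countLocal-+ {λ R a y → witnessOrOther (kind R a y)} {λ R a y → inWitness ≈ˡ kind R a y}
                                                     {λ R a y → inOtherDescent ≈ˡ kind R a y} p
                                                     (λ R a v _ → witnessOrOther-split (kind R a (next v)))) ⟩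
        1 + (slots inWitness + slots inOtherDescent)
          ≡⟨ cong (λ l → 1 + (l + slots inOtherDescent)) slots-inWitness ⟩
        suc (plrmin p + slots inOtherDescent) ∎)

    plrmin≤des : plrmin p ≤ des p
    plrmin≤des = subst (plrmin p ≤_) (sym des≡) (ℕ.m≤m+n _ _)

    private
      slots-inOtherDescent : slots inOtherDescent ≡ des p ∸ plrmin p
      slots-inOtherDescent = sym (trans (cong (_∸ plrmin p) des≡) (ℕ.m+n∸m≡n (plrmin p) _))

      multiplicity : ∀ c → occurrences c kindsOfSlots ≡ letterMultiplicity c (letterStats p)
      multiplicity afterMax       = trans (occurrences≡slots afterMax) slots-afterMax
      multiplicity inSuccession   = trans (occurrences≡slots inSuccession) slots-inSuccession
      multiplicity inBigAscent    = trans (occurrences≡slots inBigAscent) slots-inBigAscent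
      multiplicity inWitness      = trans (occurrences≡slots inWitness) slots-inWitness
      multiplicity inOtherDescent = trans (occurrences≡slots inOtherDescent) slots-inOtherDescent

    slot-stats : ∀ {R x v} → p ≡ R ++ x ∷ v → letterStats (R ++ x ∷ m ∷ v) ≡ letterEffect (kind R x (next v)) (letterStats p)
    slot-stats {R} {x} {v} split = stats-of-kind (kind R x y) plrmin≤des
      (subst₂ (λ a b → basc q + ⟦ a ⟧ ≡ basc p + ⟦ not b ⟧) bigAscent≡ (sym (isAfterMax M R x y)) bigAscent-balance)
      (subst (λ a → des q + ⟦ a ⟧ ≡ des p + 1) descent≡ descent-balance)
      (subst₂ (λ a b → suc' q + ⟦ a ⟧ ≡ suc' p + ⟦ b ⟧) succession≡ (sym (isAfterMax M R x y)) succession-balance)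
      (subst (λ a → plrmin q + ⟦ a ⟧ ≡ plrmin p) witness≡ witness-balance)
      where
      open Slot split
      open KindTests tests

    private
      y₀ : ℕ
      y₀ = next p

      y₀<m : y₀ < m
      y₀<m = s≤s (next≤M [] refl)

      basc-front : basc (m ∷ p) ≡ basc p
      basc-front = begin
        basc (m ∷ p)                                              ≡⟨ basc≡countLocal (m ∷ p) ⟩
        ⟦ not (y₀ <ᵇ suc (suc m)) ⟧ + countLocal bigAscentAt p    ≡⟨ cong (λ b → ⟦ not b ⟧ + countLocal bigAscentAt p)
                                                                        (<ᵇ-true (ℕ.m<n⇒m<1+n (ℕ.m<n⇒m<1+n y₀<m))) ⟩
        countLocal bigAscentAt p                                  ≡⟨ basc≡countLocal p ⟨
        basc p                                                    ∎

      succession-front : suc' (m ∷ p) ≡ suc' p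
      succession-front = begin
        suc' (m ∷ p)                                  ≡⟨ suc′≡countLocal (m ∷ p) ⟩
        ⟦ y₀ ≡ᵇ suc m ⟧ + countLocal successionAt p   ≡⟨ cong (λ b → ⟦ b ⟧ + countLocal successionAt p)
                                                           (≡ᵇ-false {y₀} {suc m} (ℕ.<⇒≢ (ℕ.m<n⇒m<1+n y₀<m))) ⟩
        countLocal successionAt p                     ≡⟨ suc′≡countLocal p ⟨
        suc' p                                        ∎

      des-front : des (m ∷ p) ≡ suc (des p)
      des-front = ℕ.suc-injective (begin
        suc (des (m ∷ p))                             ≡⟨ countLocal-descentAt (cons-max-perm p-perm) ⟨
        ⟦ y₀ <ᵇ m ⟧ + countLocal descentAt p          ≡⟨ cong₂ (λ b c → ⟦ b ⟧ + c) (<ᵇ-true y₀<m) (countLocal-descentAt p-perm) ⟩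
        suc (suc (des p))                             ∎)

      -- in front of everything, m is a left-to-right minimum, so the descent top M becomes a witness
      witnessed-by-M : ∀ R a v → p ≡ R ++ a ∷ v
        → ⟦ plrWitnessAt (m ∷ R) a (next v) ⟧ ≡ ⟦ plrWitnessAt R a (next v) ⟧ + ⟦ M ≡ᵇ a ⟧
      witnessed-by-M R a v split with a ℕ.≟ M
      ... | yes refl rewrite ≡ᵇ-refl M | <ᵇ-true (ℕ.≤∧≢⇒< (Slot.y≤M split) (Slot.y≢x split)) | Slot.R-noMax split = refl
      ... | no a≢M rewrite lrminIn-insert [] {R} (s≤s (ℕ.≤∧≢⇒< (Slot.x≤M split) a≢M)) | ≡ᵇ-false {M} {a} (a≢M ∘ sym) =
        sym (ℕ.+-identityʳ _)

      plrmin-front : plrmin (m ∷ p) ≡ suc (plrmin p)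
      plrmin-front = begin
        plrmin (m ∷ p)
          ≡⟨ plrmin≡countLocal (cons-max-perm p-perm) ⟩
        ⟦ (y₀ <ᵇ m) ∧ false ⟧ + countLocal (λ R → plrWitnessAt (m ∷ R)) p
          ≡⟨ cong (λ b → ⟦ b ⟧ + countLocal (λ R → plrWitnessAt (m ∷ R)) p) (∧-zeroʳ (y₀ <ᵇ m)) ⟩
        countLocal (λ R → plrWitnessAt (m ∷ R)) p
          ≡⟨ countLocal-+ {λ R → plrWitnessAt (m ∷ R)} {plrWitnessAt} {λ _ a _ → M ≡ᵇ a} p witnessed-by-M ⟩
        countLocal plrWitnessAt p + countLocal (λ _ a _ → M ≡ᵇ a) p
          ≡⟨ cong₂ _+_ (sym (plrmin≡countLocal p-perm)) M-once ⟩
        plrmin p + 1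
          ≡⟨ ℕ.+-comm (plrmin p) 1 ⟩
        suc (plrmin p) ∎

    front-stats : letterStats (m ∷ p) ≡ (basc p , des p ∸ plrmin p , suc' p , suc (plrmin p))
    front-stats = stats≡ basc-front (cong₂ _∸_ des-front plrmin-front) succession-front plrmin-front

    Σ-letterInsertions : ∀ g → ΣL (letterInsertions m p) (g ∘ letterStats) ≡ letterStep g (letterStats p)
    Σ-letterInsertions g = begin
      g (letterStats (m ∷ p)) ℚ.+ ΣL (mapSplits (λ R x v → R ++ x ∷ m ∷ v) p) (g ∘ letterStats)
        ≡⟨ cong₂ ℚ._+_ (cong g front-stats)
                       (Σ-mapSplits {h = g ∘ letterStats} {h′ = λ k → g (letterEffect k t)} p (λ R x v split → cong g (slot-stats split))) ⟩
      g front ℚ.+ ΣL kindsOfSlots (λ k → g (letterEffect k t))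
        ≡⟨ cong (g front ℚ.+_) (Σ-byKind kindsOfSlots (λ k → g (letterEffect k t))) ⟩
      g front ℚ.+ ΣL letterSlots (λ c → occurrences c kindsOfSlots · g (letterEffect c t))
        ≡⟨ cong (g front ℚ.+_) (Σ-cong letterSlots (λ {c} _ → cong (_· g (letterEffect c t)) (multiplicity c))) ⟩
      g front ℚ.+ ΣL letterSlots (λ c → letterMultiplicity c t · g (letterEffect c t))
        ≡⟨ letterStep-byKind g (basc p) (des p ∸ plrmin p) (suc' p) (plrmin p) ⟨
      letterStep g t ∎
      where
      t front : Stats
      t = letterStats p
      front = (basc p , des p ∸ plrmin p , suc' p , suc (plrmin p))

module CycleSlots where

  open Permutations
  open WeightOperators using (Stats; stats≡; cycleStep)
  open LocalStatistics
  open import Defs hiding (_^_)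
  open import Function using (_∘_; Equivalence; _⇔_; mk⇔)
  open import Algebra.Bundles using (CommutativeRing)
  open import Data.Bool using (Bool; true; false; T)
  open import Data.Bool.Properties using (T-≡; ⇔→≡; ¬-not)
  open import Data.Bool.ListAction using (all)
  open import Data.Nat as ℕ using (ℕ; zero; suc; _+_; _∸_; _≤_; _<_; z≤n; s≤s; _≡ᵇ_; _<ᵇ_; _≤ᵇ_)
  import Data.Nat.Properties as ℕ
  open import Data.Nat.Properties using (≤ᵇ⇒≤; ≤⇒≤ᵇ)
  open import Data.Nat.Induction using (<-rec)
  open import Data.Nat.ListAction using (sum)
  open import Data.Nat.ListAction.Properties using (sum-++)
  import Data.Fin as Fin
  import Data.Fin.Properties as Fin
  open import Data.Fin.Properties using (pigeonhole)
  open import Data.Product using (_×_; _,_; proj₂; ∃)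
  open import Data.Sum using (_⊎_; inj₁; inj₂)
  open import Data.List as List using (List; []; _∷_; _++_; _∷ʳ_; [_]; length)
  open import Data.List.Properties using (++-assoc; length-++)
  open import Data.List.Membership.Propositional using (_∈_)
  open import Data.List.Membership.Propositional.Properties using (∈-++⁺ʳ)
  open import Data.List.Relation.Unary.Any using (here; there)
  import Data.List.Relation.Unary.All as All
  open import Data.List.Relation.Unary.All.Properties using (all⁺; all⁻)
  open import Data.Rational as ℚ using (ℚ)
  import Data.Rational.Properties as ℚ
  open import Algebra.Properties.Semiring.Mult (CommutativeRing.semiring ℚ.+-*-commutativeRing)
    using () renaming (_×_ to _·_)
  open import Relation.Nullary using (yes; no; contradiction)
  open import Relation.Binary.Definitions using (tri<; tri≈; tri>)
  open import Relation.Binary.PropositionalEquality hiding ([_])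
  open ≡-Reasoning

  data CycleSlot : Set where
    atExcedance atDrop atFixedPoint : CycleSlot

  cycleSlots : List CycleSlot
  cycleSlots = atExcedance ∷ atDrop ∷ atFixedPoint ∷ []

  private
    cycleIndex : CycleSlot → ℕ
    cycleIndex atExcedance  = 0
    cycleIndex atDrop       = 1
    cycleIndex atFixedPoint = 2

  _≈ᶜ_ : CycleSlot → CycleSlot → Bool
  c ≈ᶜ k = cycleIndex c ≡ᵇ cycleIndex k

  cycle-decompose : ∀ (val : CycleSlot → ℚ) k → ΣL cycleSlots (λ c → ⟦ c ≈ᶜ k ⟧ · val c) ≡ val k
  cycle-decompose val atExcedance  = v+0+0≡v
  cycle-decompose val atDrop       = trans (ℚ.+-identityˡ _) v+0+0≡v
  cycle-decompose val atFixedPoint = trans (ℚ.+-identityˡ _) (trans (ℚ.+-identityˡ _) v+0+0≡v)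

  cycleKind : (excedance drop : Bool) → CycleSlot
  cycleKind true  _     = atExcedance
  cycleKind false true  = atDrop
  cycleKind false false = atFixedPoint

  -- inserting n+1 into the cycle after position i, whose value is x
  classifyCycleSlot : ℕ → ℕ → CycleSlot
  classifyCycleSlot i x = cycleKind (i <ᵇ x) (x <ᵇ i)

  record CycleTests (i x : ℕ) (k : CycleSlot) : Set where
    field
      excedance≡ : (i <ᵇ x) ≡ atExcedance ≈ᶜ k
      drop≡      : (x <ᵇ i) ≡ atDrop ≈ᶜ k
      fixed≡     : (x ≡ᵇ i) ≡ atFixedPoint ≈ᶜ k

  cycleTests : ∀ i x → CycleTests i x (classifyCycleSlot i x)
  cycleTests i x with ℕ.<-cmp i x
  ... | tri< i<x _ _ rewrite <ᵇ-true i<x =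
    record { excedance≡ = <ᵇ-true i<x ; drop≡ = <ᵇ-false (ℕ.<⇒≤ i<x) ; fixed≡ = ≡ᵇ-false (ℕ.<⇒≢ i<x ∘ sym) }
  ... | tri≈ _ refl _ rewrite <ᵇ-false (ℕ.≤-refl {i}) =
    record { excedance≡ = <ᵇ-false (ℕ.≤-refl {i}) ; drop≡ = <ᵇ-false (ℕ.≤-refl {i}) ; fixed≡ = ≡ᵇ-refl i }
  ... | tri> _ _ x<i rewrite <ᵇ-false (ℕ.<⇒≤ x<i) | <ᵇ-true x<i =
    record { excedance≡ = <ᵇ-false (ℕ.<⇒≤ x<i) ; drop≡ = <ᵇ-true x<i ; fixed≡ = ≡ᵇ-false (ℕ.<⇒≢ x<i) }

  cycleStats : List ℕ → Stats
  cycleStats π = exc π , drop π , fix π , cyc π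

  cycleEffect : CycleSlot → Stats → Stats
  cycleEffect atExcedance  (e , d , f , c) = e , suc d , f , c
  cycleEffect atDrop       (e , d , f , c) = suc e , d , f , c
  cycleEffect atFixedPoint (e , d , f , c) = suc e , suc d , f ∸ 1 , c

  cycleMultiplicity : CycleSlot → Stats → ℕ
  cycleMultiplicity atExcedance  (e , d , f , c) = e
  cycleMultiplicity atDrop       (e , d , f , c) = d
  cycleMultiplicity atFixedPoint (e , d , f , c) = f

  cycleStep-byKind : ∀ h e d f c → cycleStep h (e , d , f , c)
    ≡ h (e , d , suc f , suc c) ℚ.+ ΣL cycleSlots (λ k → cycleMultiplicity k (e , d , f , c) · h (cycleEffect k (e , d , f , c)))
  cycleStep-byKind h e d f c =
    cong (λ z → h (e , d , suc f , suc c) ℚ.+ (e · h (e , suc d , f , c) ℚ.+ (d · h (suc e , d , f , c) ℚ.+ z)))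
         (sym (ℚ.+-identityʳ (f · h (suc e , suc d , f ∸ 1 , c))))

  excedanceAt dropAt fixedAt : ℕ → ℕ → Bool
  excedanceAt i a = a >ᵇ i
  dropAt      i a = a <ᵇ i
  fixedAt     i a = a ≡ᵇ i

  exc≡countPositions : ∀ w → exc w ≡ countPositions excedanceAt w
  exc≡countPositions w = sym (countPositions≡count excedanceAt w)

  drop≡countPositions : ∀ w → drop w ≡ countPositions dropAt w
  drop≡countPositions w = sym (countPositions≡count dropAt w)

  fix≡countPositions : ∀ w → fix w ≡ countPositions fixedAt w
  fix≡countPositions w = sym (countPositions≡count fixedAt w)

  at-++ˡ : ∀ w u {j} → j ≤ length w → at (w ++ u) j ≡ at w j
  at-++ˡ []      []      {zero}        _         = refl
  at-++ˡ []      (b ∷ u) {zero}        _         = refl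
  at-++ˡ (a ∷ w) u       {zero}        _         = refl
  at-++ˡ (a ∷ w) u       {suc zero}    _         = refl
  at-++ˡ (a ∷ w) u       {suc (suc j)} (s≤s j<n) = at-++ˡ w u j<n

  at-++-∷ : ∀ w {a u} → at (w ++ a ∷ u) (suc (length w)) ≡ a
  at-++-∷ []          = refl
  at-++-∷ (b ∷ [])    = refl
  at-++-∷ (b ∷ c ∷ w) = at-++-∷ (c ∷ w)

  at-cycleInsert : ∀ R {m x v j} → j ≤ length (R ++ x ∷ v) → j ≢ suc (length R) → at (R ++ m ∷ (v ∷ʳ x)) j ≡ at (R ++ x ∷ v) j
  at-cycleInsert []      {j = zero}        _           _    = refl
  at-cycleInsert []      {j = suc zero}    _           j≢i₀ = contradiction refl j≢i₀
  at-cycleInsert []      {v = v} {suc (suc j)} (s≤s j<n) _ = at-++ˡ v _ j<n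
  at-cycleInsert (a ∷ R) {j = zero}        _           _    = refl
  at-cycleInsert (a ∷ R) {j = suc zero}    _           _    = refl
  at-cycleInsert (a ∷ R) {j = suc (suc j)} (s≤s j<n)   j≢i₀ = at-cycleInsert R j<n (j≢i₀ ∘ cong suc)

  iter-+ : ∀ w j r i → iter w (j + r) i ≡ iter w j (iter w r i)
  iter-+ w zero    r i = refl
  iter-+ w (suc j) r i = cong (at w) (iter-+ w j r i)

  cycleMinAt : List ℕ → ℕ → ℕ → Bool
  cycleMinAt w n i = all (λ k → i ≤ᵇ iter w k i) (oneTo n)

  cyc≡count : ∀ {n w} → length w ≡ n → cyc w ≡ count (cycleMinAt w n) (oneTo n)
  cyc≡count refl = refl

  module Orbits {n w} (w-perm : IsPerm n w) where
    private
      lengthw : length w ≡ n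
      lengthw = perm-length w-perm

    at-bounded : ∀ {a} → 1 ≤ a → a ≤ n → 1 ≤ at w a × at w a ≤ n
    at-bounded 1≤a a≤n = Equivalence.to (perm-∈⇔ w-perm) (at-∈ w 1≤a (subst (_ ≤_) (sym lengthw) a≤n))

    iter-bounded : ∀ {i} → 1 ≤ i → i ≤ n → ∀ k → 1 ≤ iter w k i × iter w k i ≤ n
    iter-bounded 1≤i i≤n zero    = 1≤i , i≤n
    iter-bounded 1≤i i≤n (suc k) = let 1≤ , ≤n = iter-bounded 1≤i i≤n k in at-bounded 1≤ ≤n

    private
      iter-cancel : ∀ {i} → 1 ≤ i → i ≤ n → ∀ a b → a ≤ b → iter w a i ≡ iter w b i → iter w (b ∸ a) i ≡ i
      iter-cancel         _   _   zero    b       _         eq = sym eq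
      iter-cancel {i} 1≤i i≤n (suc a) (suc b) (s≤s a≤b) eq =
        let 1≤a , a≤n = iter-bounded 1≤i i≤n a ; 1≤b , b≤n = iter-bounded 1≤i i≤n b in
        iter-cancel 1≤i i≤n a b a≤b
          (at-injective (perm-unique w-perm) 1≤a (subst (_ ≤_) (sym lengthw) a≤n) 1≤b (subst (_ ≤_) (sym lengthw) b≤n) eq)

      pred< : ∀ {a} → 1 ≤ a → a ≤ n → a ∸ 1 < n
      pred< {suc a} _ a≤n = a≤n

      pred-injective : ∀ {a b} → 1 ≤ a → 1 ≤ b → a ∸ 1 ≡ b ∸ 1 → a ≡ b
      pred-injective {suc a} {suc b} _ _ eq = cong suc eq

    -- pigeonhole on the first n + 1 iterates
    period : ∀ {i} → 1 ≤ i → i ≤ n → ∃ λ r → 1 ≤ r × r ≤ n × iter w r i ≡ i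
    period {i} 1≤i i≤n with pigeonhole (ℕ.n<1+n n) position
      where
      position : Fin.Fin (suc n) → Fin.Fin n
      position k = let 1≤ , ≤n = iter-bounded 1≤i i≤n (Fin.toℕ k) in Fin.fromℕ< (pred< 1≤ ≤n)
    ... | a , b , a<b , same =
      let 1≤a , a≤n = iter-bounded 1≤i i≤n (Fin.toℕ a) ; 1≤b , b≤n = iter-bounded 1≤i i≤n (Fin.toℕ b) in
      Fin.toℕ b ∸ Fin.toℕ a , ℕ.m<n⇒0<n∸m a<b , ℕ.≤-trans (ℕ.m∸n≤m (Fin.toℕ b) (Fin.toℕ a)) (ℕ.≤-pred (Fin.toℕ<n b)) ,
      iter-cancel 1≤i i≤n _ _ (ℕ.<⇒≤ a<b)
        (pred-injective 1≤a 1≤b (Fin.fromℕ<-injective _ _ (pred< 1≤a a≤n) (pred< 1≤b b≤n) same))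

    cycleMin⇒ : ∀ {i} → 1 ≤ i → i ≤ n → cycleMinAt w n i ≡ true → ∀ k → i ≤ iter w k i
    cycleMin⇒ {i} 1≤i i≤n isMin with period 1≤i i≤n
    ... | r , 1≤r , r≤n , back = <-rec _ step
      where
      step : ∀ k → (∀ {j} → j < k → i ≤ iter w j i) → i ≤ iter w k i
      step zero    _   = ℕ.≤-refl
      step (suc k) rec with suc k ℕ.≤? n
      ... | yes k<n = ≤ᵇ⇒≤ _ _ (All.lookup (all⁺ _ (oneTo n) (Equivalence.from T-≡ isMin)) (∈-oneTo⁺ (s≤s z≤n) k<n))
      ... | no  k≮n = subst (i ≤_) (sym shift-back) (rec (ℕ.∸-monoʳ-< 1≤r r≤k))
        where
        r≤k : r ≤ suc k
        r≤k = ℕ.≤-trans r≤n (ℕ.<⇒≤ (ℕ.≰⇒> k≮n))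
        shift-back : iter w (suc k) i ≡ iter w (suc k ∸ r) i
        shift-back = begin
          iter w (suc k) i                   ≡⟨ cong (λ j → iter w j i) (ℕ.m∸n+n≡m r≤k) ⟨
          iter w (suc k ∸ r + r) i           ≡⟨ iter-+ w (suc k ∸ r) r i ⟩
          iter w (suc k ∸ r) (iter w r i)    ≡⟨ cong (iter w (suc k ∸ r)) back ⟩
          iter w (suc k ∸ r) i               ∎

    cycleMin⇐ : ∀ {i} → (∀ k → i ≤ iter w k i) → cycleMinAt w n i ≡ true
    cycleMin⇐ isMin = Equivalence.to T-≡ (all⁻ _ {oneTo n} (All.tabulate (λ {k} _ → ≤⇒≤ᵇ (isMin k))))

    cycleMin⇔ : ∀ {i} → 1 ≤ i → i ≤ n → cycleMinAt w n i ≡ true ⇔ (∀ k → i ≤ iter w k i)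
    cycleMin⇔ 1≤i i≤n = mk⇔ (cycleMin⇒ 1≤i i≤n) cycleMin⇐

  countPositions-∷ʳ : ∀ T w a → countPositions T (w ∷ʳ a) ≡ countPositions T w + ⟦ T (suc (length w)) a ⟧
  countPositions-∷ʳ T w a = begin
    sum (mapSplits F (w ++ a ∷ []))                          ≡⟨ cong sum (mapSplits-++-∷ F w a []) ⟩
    sum (mapSplits F w ++ ⟦ T (suc (length w)) a ⟧ ∷ [])     ≡⟨ sum-++ (mapSplits F w) _ ⟩
    sum (mapSplits F w) + (⟦ T (suc (length w)) a ⟧ + 0)     ≡⟨ cong (sum (mapSplits F w) +_) (ℕ.+-identityʳ _) ⟩
    sum (mapSplits F w) + ⟦ T (suc (length w)) a ⟧           ∎
    where
    F : List ℕ → ℕ → List ℕ → ℕ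
    F R b _ = ⟦ T (suc (length R)) b ⟧

  cycle-stats-of-kind : ∀ k {e d f c e′ d′ f′}
    → e′ + ⟦ atExcedance ≈ᶜ k ⟧ ≡ e + 1
    → d′ + ⟦ atDrop ≈ᶜ k ⟧ ≡ d + 1
    → f′ + ⟦ atFixedPoint ≈ᶜ k ⟧ ≡ f
    → (e′ , d′ , f′ , c) ≡ cycleEffect k (e , d , f , c)
  cycle-stats-of-kind atExcedance  Ee Ed Ef = stats≡ (ℕ.+-cancelʳ-≡ 1 _ _ Ee) (x+0≡y+1⇒x≡1+y Ed) (x+0≡y⇒x≡y Ef) refl
  cycle-stats-of-kind atDrop       Ee Ed Ef = stats≡ (x+0≡y+1⇒x≡1+y Ee) (ℕ.+-cancelʳ-≡ 1 _ _ Ed) (x+0≡y⇒x≡y Ef) refl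
  cycle-stats-of-kind atFixedPoint Ee Ed Ef =
    stats≡ (x+0≡y+1⇒x≡1+y Ee) (x+0≡y+1⇒x≡1+y Ed) (cong (_∸ 1) (trans (ℕ.+-comm 1 _) Ef)) refl

  module CycleInsertion {N π} (π-perm : IsPerm N π) where
    private
      m : ℕ
      m = suc N
      open Orbits π-perm renaming (iter-bounded to π-bounded; cycleMin⇔ to π-cycleMin⇔)

      bounded : ∀ {a} → a ∈ π → 1 ≤ a × a ≤ N
      bounded = Equivalence.to (perm-∈⇔ π-perm)

      lengthπ : length π ≡ N
      lengthπ = perm-length π-perm

      cyc-split : ∀ {q} → length q ≡ suc N → cyc q ≡ count (cycleMinAt q (suc N)) (oneTo N) + ⟦ cycleMinAt q (suc N) m ⟧
      cyc-split {q} len = trans (cyc≡count len) (count-∷ʳ (cycleMinAt q (suc N)) (oneTo N) m)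

      same-cycleMin : ∀ {q} → IsPerm (suc N) q → ∀ {i} → 1 ≤ i → i ≤ N
        → ((∀ k → i ≤ iter π k i) → ∀ k → i ≤ iter q k i) → ((∀ k → i ≤ iter q k i) → ∀ k → i ≤ iter π k i)
        → cycleMinAt q (suc N) i ≡ cycleMinAt π N i
      same-cycleMin q-perm 1≤i i≤N π⇒q q⇒π = ⇔→≡ (mk⇔
        (λ q-min → Equivalence.from (π-cycleMin⇔ 1≤i i≤N) (q⇒π (Equivalence.to (q-cycleMin⇔ 1≤i (ℕ.m≤n⇒m≤1+n i≤N)) q-min)))
        (λ π-min → Equivalence.from (q-cycleMin⇔ 1≤i (ℕ.m≤n⇒m≤1+n i≤N)) (π⇒q (Equivalence.to (π-cycleMin⇔ 1≤i i≤N) π-min))))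
        where open Orbits q-perm using () renaming (cycleMin⇔ to q-cycleMin⇔)

    module Append where
      q : List ℕ
      q = π ∷ʳ m

      q-perm : IsPerm (suc N) q
      q-perm = InsertionScheme.sound (cycleInsertions-scheme N) π-perm (here refl)

      lengthq : length q ≡ suc N
      lengthq = perm-length q-perm

      at-old : ∀ {j} → j ≤ N → at q j ≡ at π j
      at-old j≤N = at-++ˡ π [ m ] (subst (_ ≤_) (sym lengthπ) j≤N)

      at-new : at q m ≡ m
      at-new = subst (λ n → at q (suc n) ≡ m) lengthπ (at-++-∷ π)

      iter-old : ∀ {i} → 1 ≤ i → i ≤ N → ∀ k → iter q k i ≡ iter π k i
      iter-old 1≤i i≤N zero    = refl
      iter-old 1≤i i≤N (suc k) = trans (cong (at q) (iter-old 1≤i i≤N k)) (at-old (proj₂ (π-bounded 1≤i i≤N k)))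

      iter-new : ∀ k → iter q k m ≡ m
      iter-new zero    = refl
      iter-new (suc k) = trans (cong (at q) (iter-new k)) at-new

      positions : ∀ T → countPositions T q ≡ countPositions T π + ⟦ T m m ⟧
      positions T = trans (countPositions-∷ʳ T π m) (cong (λ n → countPositions T π + ⟦ T (suc n) m ⟧) lengthπ)

      cyc-append : cyc q ≡ suc (cyc π)
      cyc-append = begin
        cyc q
          ≡⟨ cyc-split lengthq ⟩
        count (cycleMinAt q (suc N)) (oneTo N) + ⟦ cycleMinAt q (suc N) m ⟧
          ≡⟨ cong₂ _+_ (count-cong N (λ 1≤i i≤N → same-cycleMin q-perm 1≤i i≤N
                           (λ min k → subst (_ ≤_) (sym (iter-old 1≤i i≤N k)) (min k))
                           (λ min k → subst (_ ≤_) (iter-old 1≤i i≤N k) (min k))))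
                       (cong ⟦_⟧ (Equivalence.from (Orbits.cycleMin⇔ q-perm (s≤s z≤n) ℕ.≤-refl) (λ k → ℕ.≤-reflexive (sym (iter-new k))))) ⟩
        count (cycleMinAt π N) (oneTo N) + 1
          ≡⟨ cong (_+ 1) (cyc≡count lengthπ) ⟨
        cyc π + 1
          ≡⟨ ℕ.+-comm (cyc π) 1 ⟩
        suc (cyc π) ∎

      unchanged : ∀ T → T m m ≡ false → countPositions T q ≡ countPositions T π
      unchanged T m≁m = trans (positions T) (trans (cong (λ b → countPositions T π + ⟦ b ⟧) m≁m) (ℕ.+-identityʳ _))

      fix-append : fix q ≡ suc (fix π)
      fix-append = begin
        fix q                                       ≡⟨ fix≡countPositions q ⟩
        countPositions fixedAt q                    ≡⟨ positions fixedAt ⟩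
        countPositions fixedAt π + ⟦ m ≡ᵇ m ⟧       ≡⟨ cong (λ b → countPositions fixedAt π + ⟦ b ⟧) (≡ᵇ-refl m) ⟩
        countPositions fixedAt π + 1                ≡⟨ ℕ.+-comm _ 1 ⟩
        suc (countPositions fixedAt π)              ≡⟨ cong suc (fix≡countPositions π) ⟨
        suc (fix π)                                 ∎

      append-stats : cycleStats q ≡ (exc π , drop π , suc (fix π) , suc (cyc π))
      append-stats = stats≡
        (trans (exc≡countPositions q) (trans (unchanged excedanceAt (<ᵇ-false (ℕ.≤-refl {m}))) (sym (exc≡countPositions π))))
        (trans (drop≡countPositions q) (trans (unchanged dropAt (<ᵇ-false (ℕ.≤-refl {m}))) (sym (drop≡countPositions π))))
        fix-append
        cyc-append

    module Slot {R x v} (split : π ≡ R ++ x ∷ v) where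
      q : List ℕ
      q = R ++ m ∷ (v ∷ʳ x)
      i₀ : ℕ
      i₀ = suc (length R)

      q-perm : IsPerm (suc N) q
      q-perm = InsertionScheme.sound (cycleInsertions-scheme N) π-perm
        (there (subst (λ w → q ∈ mapSplits (λ R x v → R ++ m ∷ (v ∷ʳ x)) w) (sym split) (∈-mapSplits⁺ (λ R x v → R ++ m ∷ (v ∷ʳ x)) R)))

      lengthq : length q ≡ suc N
      lengthq = perm-length q-perm

      length-R-x-v : length (R ++ x ∷ v) ≡ N
      length-R-x-v = trans (cong length (sym split)) lengthπ

      length-R-m-v : length (R ++ m ∷ v) ≡ N
      length-R-m-v = trans (length-++ R) (trans (sym (length-++ R)) length-R-x-v)

      x-bounded : 1 ≤ x × x ≤ N
      x-bounded = bounded (subst (x ∈_) (sym split) (∈-++⁺ʳ R (here refl)))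

      i₀≤N : i₀ ≤ N
      i₀≤N = subst (i₀ ≤_) length-R-x-v (subst (i₀ ≤_) (sym (length-++ R))
               (ℕ.≤-trans (s≤s (ℕ.m≤m+n (length R) (length v))) (ℕ.≤-reflexive (sym (ℕ.+-suc (length R) (length v))))))

      at-other : ∀ {j} → j ≤ N → j ≢ i₀ → at q j ≡ at π j
      at-other {j} j≤N j≢i₀ = trans (at-cycleInsert R (subst (j ≤_) (sym length-R-x-v) j≤N) j≢i₀) (cong (λ w → at w j) (sym split))

      at-q-i₀ : at q i₀ ≡ m
      at-q-i₀ = at-++-∷ R

      at-π-i₀ : at π i₀ ≡ x
      at-π-i₀ = trans (cong (λ w → at w i₀) split) (at-++-∷ R)

      at-q-m : at q m ≡ x
      at-q-m = begin
        at q m                                                  ≡⟨ cong (λ w → at w m) (++-assoc R (m ∷ v) [ x ]) ⟨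
        at ((R ++ m ∷ v) ∷ʳ x) m                                ≡⟨ cong (λ n → at ((R ++ m ∷ v) ∷ʳ x) (suc n)) length-R-m-v ⟨
        at ((R ++ m ∷ v) ∷ʳ x) (suc (length (R ++ m ∷ v)))      ≡⟨ at-++-∷ (R ++ m ∷ v) ⟩
        x                                                       ∎

      module _ {i} (1≤i : 1 ≤ i) (i≤N : i ≤ N) where
        -- the q-orbit of i is its π-orbit with m inserted right after i₀
        orbit-q : ∀ k → (∃ λ k′ → iter q k i ≡ iter π k′ i) ⊎ (iter q k i ≡ m × ∃ λ k′ → iter π k′ i ≡ i₀)
        orbit-q zero = inj₁ (0 , refl)
        orbit-q (suc k) with orbit-q k
        ... | inj₂ (at-m , k′ , at-i₀) =
          inj₁ (suc k′ , trans (cong (at q) at-m) (trans at-q-m (trans (sym at-π-i₀) (cong (at π) (sym at-i₀)))))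
        ... | inj₁ (k′ , same) with iter π k′ i ℕ.≟ i₀
        ...   | yes at-i₀ = inj₂ (trans (cong (at q) (trans same at-i₀)) at-q-i₀ , k′ , at-i₀)
        ...   | no  not-i₀ = inj₁ (suc k′ , trans (cong (at q) same) (at-other (proj₂ (π-bounded 1≤i i≤N k′)) not-i₀))

        orbit-π : ∀ k′ → ∃ λ k → iter π k′ i ≡ iter q k i
        orbit-π zero = 0 , refl
        orbit-π (suc k′) with orbit-π k′ | iter π k′ i ℕ.≟ i₀
        ... | k , same | no not-i₀ = suc k , trans (sym (at-other (proj₂ (π-bounded 1≤i i≤N k′)) not-i₀)) (cong (at q) same)
        ... | k , same | yes at-i₀ = suc (suc k) , (begin
          at π (iter π k′ i)    ≡⟨ cong (at π) at-i₀ ⟩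
          at π i₀               ≡⟨ at-π-i₀ ⟩
          x                     ≡⟨ at-q-m ⟨
          at q m                ≡⟨ cong (at q) at-q-i₀ ⟨
          at q (at q i₀)        ≡⟨ cong (at q ∘ at q) (trans (sym at-i₀) same) ⟩
          at q (at q (iter q k i)) ∎)

        cycleMin-old : cycleMinAt q (suc N) i ≡ cycleMinAt π N i
        cycleMin-old = same-cycleMin q-perm 1≤i i≤N π⇒q q⇒π
          where
          π⇒q : (∀ k → i ≤ iter π k i) → ∀ k → i ≤ iter q k i
          π⇒q min k with orbit-q k
          ... | inj₁ (k′ , same) = subst (i ≤_) (sym same) (min k′)
          ... | inj₂ (at-m , _)  = subst (i ≤_) (sym at-m) (ℕ.m≤n⇒m≤1+n i≤N)
          q⇒π : (∀ k → i ≤ iter q k i) → ∀ k → i ≤ iter π k i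
          q⇒π min k′ = let k , same = orbit-π k′ in subst (i ≤_) (sym same) (min k)

      m-not-min : cycleMinAt q (suc N) m ≡ false
      m-not-min = ¬-not λ min → ℕ.<⇒≱ (s≤s (proj₂ x-bounded))
        (subst (m ≤_) at-q-m (Equivalence.to (Orbits.cycleMin⇔ q-perm (s≤s z≤n) ℕ.≤-refl) min 1))

      cyc-slot : cyc q ≡ cyc π
      cyc-slot = begin
        cyc q                                                                   ≡⟨ cyc-split lengthq ⟩
        count (cycleMinAt q (suc N)) (oneTo N) + ⟦ cycleMinAt q (suc N) m ⟧     ≡⟨ cong₂ _+_ (count-cong N cycleMin-old) (cong ⟦_⟧ m-not-min) ⟩
        count (cycleMinAt π N) (oneTo N) + 0                                    ≡⟨ ℕ.+-identityʳ _ ⟩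
        count (cycleMinAt π N) (oneTo N)                                        ≡⟨ cyc≡count lengthπ ⟨
        cyc π                                                                   ∎

      balance : ∀ T → countPositions T q + ⟦ T i₀ x ⟧ ≡ countPositions T π + (⟦ T i₀ m ⟧ + ⟦ T m x ⟧)
      balance T = trans (countPositions-insert T R x m v)
        (cong₂ (λ w n → countPositions T w + (⟦ T i₀ m ⟧ + ⟦ T (suc n) x ⟧)) (sym split) length-R-m-v)

      x<m : x < m
      x<m = s≤s (proj₂ x-bounded)

      excedance-balance : exc q + ⟦ i₀ <ᵇ x ⟧ ≡ exc π + 1
      excedance-balance = begin
        exc q + ⟦ i₀ <ᵇ x ⟧
          ≡⟨ cong (_+ ⟦ i₀ <ᵇ x ⟧) (exc≡countPositions q) ⟩
        countPositions excedanceAt q + ⟦ i₀ <ᵇ x ⟧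
          ≡⟨ balance excedanceAt ⟩
        countPositions excedanceAt π + (⟦ i₀ <ᵇ m ⟧ + ⟦ m <ᵇ x ⟧)
          ≡⟨ cong₂ _+_ (sym (exc≡countPositions π)) (cong₂ (λ a b → ⟦ a ⟧ + ⟦ b ⟧) (<ᵇ-true (s≤s i₀≤N)) (<ᵇ-false (ℕ.<⇒≤ x<m))) ⟩
        exc π + 1 ∎

      drop-balance : drop q + ⟦ x <ᵇ i₀ ⟧ ≡ drop π + 1
      drop-balance = begin
        drop q + ⟦ x <ᵇ i₀ ⟧
          ≡⟨ cong (_+ ⟦ x <ᵇ i₀ ⟧) (drop≡countPositions q) ⟩
        countPositions dropAt q + ⟦ x <ᵇ i₀ ⟧
          ≡⟨ balance dropAt ⟩
        countPositions dropAt π + (⟦ m <ᵇ i₀ ⟧ + ⟦ x <ᵇ m ⟧)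
          ≡⟨ cong₂ _+_ (sym (drop≡countPositions π)) (cong₂ (λ a b → ⟦ a ⟧ + ⟦ b ⟧) (<ᵇ-false (ℕ.m≤n⇒m≤1+n i₀≤N)) (<ᵇ-true x<m)) ⟩
        drop π + 1 ∎

      fixed-balance : fix q + ⟦ x ≡ᵇ i₀ ⟧ ≡ fix π
      fixed-balance = begin
        fix q + ⟦ x ≡ᵇ i₀ ⟧
          ≡⟨ cong (_+ ⟦ x ≡ᵇ i₀ ⟧) (fix≡countPositions q) ⟩
        countPositions fixedAt q + ⟦ x ≡ᵇ i₀ ⟧
          ≡⟨ balance fixedAt ⟩
        countPositions fixedAt π + (⟦ m ≡ᵇ i₀ ⟧ + ⟦ x ≡ᵇ m ⟧)
          ≡⟨ cong₂ _+_ (sym (fix≡countPositions π))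
                       (cong₂ (λ a b → ⟦ a ⟧ + ⟦ b ⟧) (≡ᵇ-false (ℕ.<⇒≢ (s≤s i₀≤N) ∘ sym)) (≡ᵇ-false (ℕ.<⇒≢ x<m))) ⟩
        fix π + 0
          ≡⟨ ℕ.+-identityʳ _ ⟩
        fix π ∎

      slot-stats : cycleStats q ≡ cycleEffect (classifyCycleSlot i₀ x) (cycleStats π)
      slot-stats = trans (cong (λ c → exc q , drop q , fix q , c) cyc-slot) (cycle-stats-of-kind (classifyCycleSlot i₀ x)
        (subst (λ b → exc q + ⟦ b ⟧ ≡ exc π + 1) excedance≡ excedance-balance)
        (subst (λ b → drop q + ⟦ b ⟧ ≡ drop π + 1) drop≡ drop-balance)
        (subst (λ b → fix q + ⟦ b ⟧ ≡ fix π) fixed≡ fixed-balance))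
        where open CycleTests (cycleTests i₀ x)

    open ByKind cycleSlots _≈ᶜ_ cycle-decompose

    kindsOfSlots : List CycleSlot
    kindsOfSlots = mapSplits (λ R x v → classifyCycleSlot (suc (length R)) x) π

    private
      slots : CycleSlot → ℕ
      slots c = countPositions (λ i a → c ≈ᶜ classifyCycleSlot i a) π

      slots≡ : ∀ {T} c → (∀ i a → c ≈ᶜ classifyCycleSlot i a ≡ T i a) → slots c ≡ countPositions T π
      slots≡ c same = cong sum (mapSplits-cong π (λ R a _ _ → cong ⟦_⟧ (same (suc (length R)) a)))

      multiplicity : ∀ c → occurrences c kindsOfSlots ≡ cycleMultiplicity c (cycleStats π)
      multiplicity atExcedance = trans (cong sum (map-mapSplits _ _ π))
        (trans (slots≡ atExcedance (λ i a → sym (CycleTests.excedance≡ (cycleTests i a)))) (sym (exc≡countPositions π)))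
      multiplicity atDrop = trans (cong sum (map-mapSplits _ _ π))
        (trans (slots≡ atDrop (λ i a → sym (CycleTests.drop≡ (cycleTests i a)))) (sym (drop≡countPositions π)))
      multiplicity atFixedPoint = trans (cong sum (map-mapSplits _ _ π))
        (trans (slots≡ atFixedPoint (λ i a → sym (CycleTests.fixed≡ (cycleTests i a)))) (sym (fix≡countPositions π)))

    Σ-cycleInsertions : ∀ h → ΣL (cycleInsertions m π) (h ∘ cycleStats) ≡ cycleStep h (cycleStats π)
    Σ-cycleInsertions h = begin
      h (cycleStats (π ∷ʳ m)) ℚ.+ ΣL (mapSplits (λ R x v → R ++ m ∷ (v ∷ʳ x)) π) (h ∘ cycleStats)
        ≡⟨ cong₂ ℚ._+_ (cong h Append.append-stats)
                       (Σ-mapSplits {h = h ∘ cycleStats} {h′ = λ k → h (cycleEffect k t)} π (λ R x v split → cong h (Slot.slot-stats split))) ⟩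
      h appended ℚ.+ ΣL kindsOfSlots (λ k → h (cycleEffect k t))
        ≡⟨ cong (h appended ℚ.+_) (Σ-byKind kindsOfSlots (λ k → h (cycleEffect k t))) ⟩
      h appended ℚ.+ ΣL cycleSlots (λ c → occurrences c kindsOfSlots · h (cycleEffect c t))
        ≡⟨ cong (h appended ℚ.+_) (Σ-cong cycleSlots (λ {c} _ → cong (_· h (cycleEffect c t)) (multiplicity c))) ⟩
      h appended ℚ.+ ΣL cycleSlots (λ c → cycleMultiplicity c t · h (cycleEffect c t))
        ≡⟨ cycleStep-byKind h (exc π) (drop π) (fix π) (cyc π) ⟨
      cycleStep h t ∎
      where
      t appended : Stats
      t = cycleStats π
      appended = (exc π , drop π , suc (fix π) , suc (cyc π))

open Permutations
open WeightOperators
open LetterSlots using (letterStats; module LetterInsertion)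
open CycleSlots using (cycleStats; module CycleInsertion)
open import Defs
open import Function using (_∘_; Equivalence)
open import Data.Nat using (ℕ; _∸_; zero) renaming (suc to 1+)
open import Data.Product using (_×_; _,_)
open import Data.Rational using (ℚ; _+_; _*_; ½; 0ℚ)
import Data.Rational.Properties as ℚ
open import Data.List.Membership.Propositional using (_∈_)
open import Relation.Binary.PropositionalEquality
open ≡-Reasoning

transfer-theorem : ∀ n (g : Stats → ℚ) → ΣL (perms (1+ n)) (g ∘ letterStats) ≡ ΣL (perms n) (transfer g ∘ cycleStats)
-- 𝔖₁ = [[1]] and 𝔖₀ = [[]]: both sides are g (0 , 0 , 0 , 0)
transfer-theorem zero    g = cong (_+ 0ℚ) (sym (ℚ.*-identityˡ (g (0 , 0 , 0 , 0))))
transfer-theorem (1+ n) g = begin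
  ΣL (perms (1+ (1+ n))) (g ∘ letterStats)
    ≡⟨ Σ-insertionScheme (letterInsertions-scheme (1+ n)) (g ∘ letterStats) ⟩
  ΣL (perms (1+ n)) (λ p → ΣL (letterInsertions (1+ (1+ n)) p) (g ∘ letterStats))
    ≡⟨ Σ-cong (perms (1+ n)) (λ p∈ → LetterInsertion.Σ-letterInsertions (perm p∈) g) ⟩
  ΣL (perms (1+ n)) (letterStep g ∘ letterStats)
    ≡⟨ transfer-theorem n (letterStep g) ⟩
  ΣL (perms n) (transfer (letterStep g) ∘ cycleStats)
    ≡⟨ Σ-cong (perms n) {transfer (letterStep g) ∘ cycleStats} (λ {π} _ → transfer-letterStep g (cycleStats π)) ⟩
  ΣL (perms n) (cycleStep (transfer g) ∘ cycleStats)
    ≡⟨ Σ-cong (perms n) (λ π∈ → CycleInsertion.Σ-cycleInsertions (perm π∈) (transfer g)) ⟨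
  ΣL (perms n) (λ π → ΣL (cycleInsertions (1+ n) π) (transfer g ∘ cycleStats))
    ≡⟨ Σ-insertionScheme (cycleInsertions-scheme n) (transfer g ∘ cycleStats) ⟨
  ΣL (perms (1+ n)) (transfer g ∘ cycleStats) ∎
  where
  perm : ∀ {k π} → π ∈ perms k → IsPerm k π
  perm {k} = Equivalence.to (∈-perms⇔ {k})

theorem4p2 : (n : ℕ) (x y s t : ℚ) →
    (Σ[ perms (1+ n) ] (λ π → (((x ^ basc π) * (y ^ (des π ∸ plrmin π))) * (s ^ suc' π)) * (t ^ plrmin π))
      ≡ Σ[ perms n ] (λ π → (((x ^ exc π) * (y ^ drop π)) * (((t + s) * ½) ^ fix π)) * (2ℚ ^ cyc π)))
  × (Σ[ perms (1+ n) ] (λ π → ((x ^ basc π) * (y ^ des π)) * (s ^ suc' π))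
      ≡ Σ[ perms n ] (λ π → (((x ^ exc π) * (y ^ drop π)) * (((y + s) * ½) ^ fix π)) * (2ℚ ^ cyc π)))
theorem4p2 n x y s t = general t , trans (Σ-cong (perms (1+ n)) diagonal) (general y)
  where
  general : ∀ t → ΣL (perms (1+ n)) (weight x y s t ∘ letterStats)
    ≡ ΣL (perms n) (λ π → (((x ^ exc π) * (y ^ drop π)) * (((t + s) * ½) ^ fix π)) * (2ℚ ^ cyc π))
  general t = trans (transfer-theorem n (weight x y s t))
                    (Σ-cong (perms n) (λ {π} _ → transfer-weight x y s t (exc π) (drop π) (fix π) (cyc π)))
  diagonal : ∀ {π} → π ∈ perms (1+ n) → ((x ^ basc π) * (y ^ des π)) * (s ^ suc' π) ≡ weight x y s y (letterStats π)
  diagonal {π} π∈ = weight-diagonal x y s {basc π} {suc' π} (LetterInsertion.plrmin≤des (Equivalence.to (∈-perms⇔ {1+ n}) π∈))
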